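{- Let $n\geq4$ be even and let $\sigma\in D_n$ be a reflection with no fixed points in $\{1,\dots,n\}$. Then (i) $\mathrm{fix}_{G_n}(\sigma) = 2^{n/2} - 2^{(n+4)/4}+1$ if $n\equiv0\pmod4$, and $\mathrm{fix}_{G_n}(\sigma) = 2^{n/2} - 2^{(n+6)/4}+2$ if $n\equiv2\pmod4$; (ii) for any $3\leq m\leq n$, $\mathrm{fix}_{G_{m,n}}(\sigma) = \binom{n/2}{m/2} -2\binom{\lfloor (n+2)/4\rfloor}{m/2}$.
   Context: For $n\geq3$, let $T_n$ be the set of $n$-tuples $(a_1,\dots,a_n)$ with entries in $\{0,1\}$, positions regarded cyclically modulo $n$. A block of 0's of length $l$ is a sequence of $l$ cyclically consecutive positions (possibly wrapping around) all with entry $0$, not contained in a longer such sequence. With $k=\lfloor n/2\rfloor$, a block is bad if its length is at least $k-1$ ($n=2k$ even) or at least $k$ ($n=2k+1$ odd); a tuple is bad if it has a bad block (the all-zero tuple is bad), good otherwise. $G_n$ is the set of good tuples and $G_{m,n}$ the set of good tuples with exactly $m$ ones. $D_n$ is the dihedral group of permutations of $\{1,\dots,n\}$ consisting of the rotations $x\mapsto q+x \pmod n$ and reflections $x\mapsto q-x\pmod n$; it acts on $T_n$ by $\sigma\cdot(a_1,\dots,a_n)=(a_{\sigma^{ -1}(1)},\dots,a_{\sigma^{ -1}(n)})$, preserving $G_n$ and $G_{m,n}$. For a set $X$ and $\sigma\in D_n$, $\mathrm{fix}_X(\sigma)$ is the number of $\mathbf a\in X$ with $\sigma\cdot\mathbf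 a=\mathbf a$. Binomial coefficients $\binom ab$ are $0$ unless $a,b$ are non-negative integers with $b\le a$ (so $\binom{x}{m/2}=0$ for odd $m$). -}

module Defs where

open import Data.Bool using (Bool; true; false; _∧_; _∨_; not; if_then_else_)
open import Data.Nat using (ℕ; zero; suc; _+_; _∸_; _≤ᵇ_; _≡ᵇ_)
open import Data.Nat.DivMod using (_%_; _/_; m%n<n)
open import Data.Nat.Combinatorics using (_C_)
open import Data.Fin using (fromℕ<)
open import Data.Vec using (Vec; []; _∷_; lookup)
open import Data.List using (List; []; _∷_; map; _++_; filter; length)
open import Data.Bool.Properties using (T?)

-- Tuples in T_n are Vec Bool n (true = 1, false = 0); positions are
-- 0,…,n-1 (the paper's 1,…,n shifted by one), read cyclically mod n.

allTuples : (n : ℕ) → List (Vec Bool n)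
allTuples zero = [] ∷ []
allTuples (suc n) = map (true ∷_) (allTuples n) ++ map (false ∷_) (allTuples n)

entry : ∀ {n} → Vec Bool n → ℕ → Bool
entry {zero} [] _ = false
entry {suc n} v k = lookup v (fromℕ< (m%n<n k (suc n)))

allBelow : ℕ → (ℕ → Bool) → Bool
allBelow zero p = true
allBelow (suc b) p = allBelow b p ∧ p b

anyBelow : ℕ → (ℕ → Bool) → Bool
anyBelow zero p = false
anyBelow (suc b) p = anyBelow b p ∨ p b

isEven : ℕ → Bool
isEven m = (m % 2) ≡ᵇ 0

-- Minimal length of a bad block: k-1 (n = 2k) or k (n = 2k+1).
badLength : ℕ → ℕ
badLength n = if isEven n then n / 2 ∸ 1 else n / 2

allZero : ∀ {n} → Vec Bool n → Bool
allZero {n} a = allBelow n (λ i → not (entry a i))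

-- There is a block of 0's (maximal run of cyclically consecutive zeros)
-- starting at s of length l with badLength n ≤ l < n: positions s,…,s+l-1
-- are 0 and the neighbouring positions s-1 and s+l are 1.
hasBadBlock : ∀ {n} → Vec Bool n → Bool
hasBadBlock {n} a =
  anyBelow n (λ s → anyBelow n (λ l →
    (badLength n ≤ᵇ l)
    ∧ allBelow l (λ j → not (entry a (s + j)))
    ∧ entry a (s + n ∸ 1)
    ∧ entry a (s + l)))

isBad : ∀ {n} → Vec Bool n → Bool
isBad a = allZero a ∨ hasBadBlock a

isGood : ∀ {n} → Vec Bool n → Bool
isGood a = not (isBad a)

ones : ∀ {n} → Vec Bool n → ℕ
ones [] = 0
ones (true ∷ v) = suc (ones v)
ones (false ∷ v) = ones v

reflect : (n q x : ℕ) → ℕ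
reflect zero q x = 0
reflect (suc n) q x = (q + suc n ∸ x) % suc n

beq : Bool → Bool → Bool
beq true b = b
beq false b = not b

-- σ·a = a for the reflection σ = reflect n q (σ is an involution, so
-- σ⁻¹ = σ): a_{σ(x)} = a_x for all positions x.
fixedByReflection : ∀ {n} → ℕ → Vec Bool n → Bool
fixedByReflection {n} q a = allBelow n (λ x → beq (entry a (reflect n q x)) (entry a x))

fixG : (n q : ℕ) → ℕ
fixG n q = length (filter (λ a → T? (isGood a ∧ fixedByReflection q a)) (allTuples n))

fixGm : (m n q : ℕ) → ℕ
fixGm m n q = length (filter (λ a → T? (isGood a ∧ (ones a ≡ᵇ m) ∧ fixedByReflection q a)) (allTuples n))

binomHalf : ℕ → ℕ → ℕ
binomHalf a m = if isEven m then a C (m / 2) else 0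

-- Let n = 2k and let σ : x ↦ q - x (mod n) have no fixed point, so that q = 2p + 1
-- is odd.  A tuple fixed by σ is determined by its half b = (a_{p+1}, …, a_{p+k}),
-- and it is the rotation of the palindrome b ++ reverse b that moves the mirror axis
-- of the palindrome onto that of σ; this is a bijection between Vec Bool k and the
-- fixed tuples, doubling the number of ones.  Write k = r + c with c = r + e,
-- e ∈ {0, 1}.  A tuple with a one is bad exactly when it has a zero window of length
-- k - 1, and the palindrome of b has one exactly when b vanishes on its first r or
-- on its last r positions.  Inclusion–exclusion over these two end segments counts
-- the good halves as X k - 2 X c + X e, where X f counts the tuples of length f
-- (with twice their number of ones equal to m, for part (ii)); this gives
-- 2^k - 2^(c+1) + 2^e and C(k, m/2) - 2 C(c, m/2) + C(e, m/2).
module Submission where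

open import Defs
open import Data.Nat using (ℕ; _+_; _≤_; _<_; _^_; _/_; _%_)
open import Data.Integer as ℤ using (ℤ; +_)
open import Data.Product using (_×_)
open import Relation.Binary.PropositionalEquality using (_≡_; _≢_)

open import Data.Nat using (zero; suc; _*_; _∸_; z≤n; s≤s; s≤s⁻¹; _≤ᵇ_; _<ᵇ_; _≡ᵇ_; _⊓_; NonZero)
open import Data.Nat.Properties
open import Data.Nat.DivMod
open import Data.Nat.Divisibility using (divides)
open import Data.Nat.Combinatorics using (_C_; nCk+nC[k+1]≡[n+1]C[k+1]; k>n⇒nCk≡0)
open import Data.Nat.Tactic.RingSolver using (solve; solve-∀)
import Data.Integer.Properties as ℤ
import Data.Integer.Tactic.RingSolver as ℤ-Solver
open import Data.Bool using (Bool; true; false; _∧_; _∨_; not; if_then_else_; T)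
open import Data.Bool.Properties using (T?; ∧-conicalˡ; ∧-conicalʳ; ∧-zeroʳ; ∧-identityʳ; ∨-zeroʳ; ∨-∧-booleanAlgebra)
import Data.Bool.Properties as Bool
open import Algebra.Lattice.Properties.BooleanAlgebra ∨-∧-booleanAlgebra using (deMorgan₂)
open import Data.Vec as V using (Vec; []; _∷_; _∷ʳ_; lookup)
open import Data.Vec.Properties using (reverse-∷; ≡-dec)
open import Data.List as L using (List; []; _∷_; filter; length)
open import Data.Product using (∃; _,_; proj₁; proj₂)
open import Data.Sum using (_⊎_; inj₁; inj₂; [_,_]′)
open import Data.Empty using (⊥-elim)
open import Data.Fin using (fromℕ<)
open import Function using (_∘_)
open import Relation.Nullary using (yes; no; does)
open import Relation.Binary.Definitions using (DecidableEquality)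
open import Relation.Binary.PropositionalEquality using (refl; sym; trans; cong; cong₂; subst; subst₂; module ≡-Reasoning)

-- Linear arithmetic: X ≡ Y follows from A ≡ B when X + B ≡ Y + A is a polynomial
-- identity (discharged by the ring solver).  Several hypotheses are combined into a
-- single A ≡ B by adding them with cong₂ _+_.
linear : ∀ {X Y A B : ℕ} → A ≡ B → X + B ≡ Y + A → X ≡ Y
linear {X} {Y} {A} {B} h e = +-cancelʳ-≡ B X Y (trans e (cong (_+_ Y) h))

+-swap-last : ∀ x y z → x + y + z ≡ x + z + y
+-swap-last = solve-∀

+-double : ∀ x y → x + 2 * y ≡ x + y + y
+-double = solve-∀

-- The atoms of a ring-solver call; they must be bound variables, which is why
-- differences are introduced by by-difference below rather than by let.
atoms : ∀ {n} → Vec ℕ n → List ℕ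
atoms = V.toList

-- An order fact presented by its difference, the form in which linear consumes it.
difference : ∀ {m n} → m ≤ n → ∃ λ δ → m + δ ≡ n
difference m≤n = m≤n⇒∃[o]m+o≡n m≤n

from-difference : ∀ {m n} δ → m + δ ≡ n → m ≤ n
from-difference {m} δ refl = m≤m+n m δ

-- Case analysis on the difference, binding it as a genuine variable for the solver.
by-difference : ∀ {m n} {A : Set} → m ≤ n → (∀ δ → m + δ ≡ n → A) → A
by-difference m≤n k = k (proj₁ (difference m≤n)) (proj₂ (difference m≤n))

mod-from-multiples : ∀ {N} .{{_ : NonZero N}} A B u v → A + u * N ≡ B + v * N → A % N ≡ B % N
mod-from-multiples {N} A B u v h =
  trans (sym ([m+kn]%n≡m%n A u N)) (trans (cong (_% N) h) ([m+kn]%n≡m%n B v N))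

%-absorbˡ : ∀ x j N .{{_ : NonZero N}} → (x % N + j) % N ≡ (x + j) % N
%-absorbˡ x j N = trans (%-distribˡ-+ (x % N) j N)
  (trans (cong (λ t → (t + j % N) % N) (m%n%n≡m%n x N)) (sym (%-distribˡ-+ x j N)))

the-multiple-between : ∀ {N} .{{_ : NonZero N}} z → z % N ≡ 0 → 0 < z → z < N + N → z ≡ N
the-multiple-between {N} z z%N≡0 0<z z<2N with z / N | m≡m%n+[m/n]*n z N
... | zero | z≡ rewrite z%N≡0 = ⊥-elim (<-irrefl (sym z≡) 0<z)
... | suc zero | z≡ rewrite z%N≡0 = trans z≡ (+-identityʳ N)
... | suc (suc u) | z≡ rewrite z%N≡0 =
  ⊥-elim (<-irrefl refl (<-≤-trans z<2N (subst (N + N ≤_) (sym z≡) (+-monoʳ-≤ N (m≤m+n N (u * N))))))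

quotient-by-4 : ∀ a b → a < 4 → (a + b * 4) / 4 ≡ b
quotient-by-4 a b a<4 = trans (+-distrib-/-∣ʳ a (divides b refl)) (cong₂ _+_ (m<n⇒m/n≡0 a<4) (m*n/n≡m b 4))

double≡*2 : ∀ k → k + k ≡ k * 2
double≡*2 k = trans (cong (_+_ k) (sym (+-identityʳ k))) (*-comm 2 k)

double-even : ∀ k → (k + k) % 2 ≡ 0
double-even k = trans (cong (_% 2) (double≡*2 k)) (m*n%n≡0 k 2)

double-half : ∀ k → (k + k) / 2 ≡ k
double-half k = trans (cong (_/ 2) (double≡*2 k)) (m*n/n≡m k 2)

parity : ∀ m → (∃ λ i → m ≡ i + i) ⊎ (∃ λ i → m ≡ suc (i + i))
parity zero = inj₁ (0 , refl)
parity (suc m) with parity m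
... | inj₁ (i , m≡2i) = inj₂ (i , cong suc m≡2i)
... | inj₂ (i , m≡2i+1) = inj₁ (suc i , trans (cong suc m≡2i+1) (cong suc (sym (+-suc i i))))

sumL : {A : Set} → (A → ℕ) → List A → ℕ
sumL f [] = 0
sumL f (x ∷ xs) = f x + sumL f xs

sumL-++ : {A : Set} (f : A → ℕ) (xs ys : List A) → sumL f (xs L.++ ys) ≡ sumL f xs + sumL f ys
sumL-++ f [] ys = refl
sumL-++ f (x ∷ xs) ys = trans (cong (_+_ (f x)) (sumL-++ f xs ys)) (sym (+-assoc (f x) _ _))

sumL-map : {A B : Set} (f : B → ℕ) (g : A → B) (xs : List A) → sumL f (L.map g xs) ≡ sumL (f ∘ g) xs
sumL-map f g [] = refl
sumL-map f g (x ∷ xs) = cong (_+_ (f (g x))) (sumL-map f g xs)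

sumL-cong : {A : Set} {f g : A → ℕ} (xs : List A) → (∀ x → f x ≡ g x) → sumL f xs ≡ sumL g xs
sumL-cong [] h = refl
sumL-cong (x ∷ xs) h = cong₂ _+_ (h x) (sumL-cong xs h)

sumL-zero : {A : Set} (xs : List A) → sumL (λ _ → 0) xs ≡ 0
sumL-zero [] = refl
sumL-zero (x ∷ xs) = sumL-zero xs

sumL-+ : {A : Set} (f g : A → ℕ) (xs : List A) → sumL (λ x → f x + g x) xs ≡ sumL f xs + sumL g xs
sumL-+ f g [] = refl
sumL-+ f g (x ∷ xs) = trans (cong (_+_ (f x + g x)) (sumL-+ f g xs)) (+-+-interchange (f x) (g x) _ _)
  where
  +-+-interchange : ∀ a b c d → a + b + (c + d) ≡ a + c + (b + d)
  +-+-interchange = solve-∀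

sumL-swap : {A B : Set} (f : A → B → ℕ) (xs : List A) (ys : List B) →
  sumL (λ x → sumL (f x) ys) xs ≡ sumL (λ y → sumL (λ x → f x y) xs) ys
sumL-swap f [] ys = sym (sumL-zero ys)
sumL-swap f (x ∷ xs) ys = trans (cong (_+_ (sumL (f x) ys)) (sumL-swap f xs ys))
  (sym (sumL-+ (f x) (λ y → sumL (λ x′ → f x′ y) xs) ys))

indicator : Bool → ℕ
indicator true = 1
indicator false = 0

count : {A : Set} → (A → Bool) → List A → ℕ
count P = sumL (indicator ∘ P)

length-filter : {A : Set} (P : A → Bool) (xs : List A) → length (filter (λ a → T? (P a)) xs) ≡ count P xs
length-filter P [] = refl
length-filter P (x ∷ xs) with P x
... | true = cong suc (length-filter P xs)
... | false = length-filter P xs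

sumL-allTuples-suc : ∀ m (f : Vec Bool (suc m) → ℕ) →
  sumL f (allTuples (suc m)) ≡ sumL (f ∘ (true ∷_)) (allTuples m) + sumL (f ∘ (false ∷_)) (allTuples m)
sumL-allTuples-suc m f = trans (sumL-++ f (L.map (true ∷_) (allTuples m)) (L.map (false ∷_) (allTuples m)))
  (cong₂ _+_ (sumL-map f (true ∷_) (allTuples m)) (sumL-map f (false ∷_) (allTuples m)))

_≟ᵥ_ : ∀ {m} → DecidableEquality (Vec Bool m)
_≟ᵥ_ = ≡-dec Bool._≟_

count-singleton : ∀ {m} (c : Vec Bool m) → count (λ a → does (a ≟ᵥ c)) (allTuples m) ≡ 1
count-singleton [] = refl
count-singleton {suc m} (true ∷ c) = begin
    count (λ a → does (a ≟ᵥ (true ∷ c))) (allTuples (suc m))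
  ≡⟨ sumL-allTuples-suc m _ ⟩
    count (λ a → does (a ≟ᵥ c)) (allTuples m) + sumL (λ _ → 0) (allTuples m)
  ≡⟨ cong₂ _+_ (count-singleton c) (sumL-zero (allTuples m)) ⟩
    1 ∎
  where open ≡-Reasoning
count-singleton {suc m} (false ∷ c) = begin
    count (λ a → does (a ≟ᵥ (false ∷ c))) (allTuples (suc m))
  ≡⟨ sumL-allTuples-suc m _ ⟩
    sumL (λ _ → 0) (allTuples m) + count (λ a → does (a ≟ᵥ c)) (allTuples m)
  ≡⟨ cong₂ _+_ (sumL-zero (allTuples m)) (count-singleton c) ⟩
    1 ∎
  where open ≡-Reasoning

-- Both sides count the pairs (a , b) with Q b and a = F b.
count-bijection : ∀ {n k} (P : Vec Bool n → Bool) (Q : Vec Bool k → Bool)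
  (F : Vec Bool k → Vec Bool n) (G : Vec Bool n → Vec Bool k) →
  (∀ b → G (F b) ≡ b) → (∀ a → P a ≡ true → F (G a) ≡ a) → (∀ b → P (F b) ≡ Q b) →
  count P (allTuples n) ≡ count Q (allTuples k)
count-bijection {n} {k} P Q F G GF FG PF = begin
    sumL (indicator ∘ P) (allTuples n)
  ≡⟨ sumL-cong (allTuples n) (λ a → sym (pairs-over-b a)) ⟩
    sumL (λ a → sumL (pair a) (allTuples k)) (allTuples n)
  ≡⟨ sumL-swap pair (allTuples n) (allTuples k) ⟩
    sumL (λ b → sumL (λ a → pair a b) (allTuples n)) (allTuples k)
  ≡⟨ sumL-cong (allTuples k) pairs-over-a ⟩
    sumL (indicator ∘ Q) (allTuples k) ∎
  where
  open ≡-Reasoning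
  pair : Vec Bool n → Vec Bool k → ℕ
  pair a b = indicator (Q b ∧ does (a ≟ᵥ F b))

  pairs-over-a : ∀ b → sumL (λ a → pair a b) (allTuples n) ≡ indicator (Q b)
  pairs-over-a b with Q b
  ... | true = count-singleton (F b)
  ... | false = sumL-zero (allTuples n)

  partner : ∀ a → P a ≡ true → ∀ b → pair a b ≡ indicator (does (b ≟ᵥ G a))
  partner a pa b with a ≟ᵥ F b | b ≟ᵥ G a
  ... | yes refl | yes _ = cong (λ x → indicator (x ∧ true)) (trans (sym (PF b)) pa)
  ... | yes refl | no b≢Ga = ⊥-elim (b≢Ga (sym (GF b)))
  ... | no _ | no _ = cong indicator (∧-zeroʳ (Q b))
  ... | no a≢Fb | yes refl = ⊥-elim (a≢Fb (sym (FG a pa)))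

  no-partner : ∀ a → P a ≡ false → ∀ b → pair a b ≡ 0
  no-partner a pa b with a ≟ᵥ F b
  ... | yes refl = cong (λ x → indicator (x ∧ true)) (trans (sym (PF b)) pa)
  ... | no _ = cong indicator (∧-zeroʳ (Q b))

  pairs-over-b : ∀ a → sumL (pair a) (allTuples k) ≡ indicator (P a)
  pairs-over-b a with P a in pa
  ... | true = trans (sumL-cong (allTuples k) (partner a pa)) (count-singleton (G a))
  ... | false = trans (sumL-cong (allTuples k) (no-partner a pa)) (sumL-zero (allTuples k))

count-all : ∀ f → count (λ (v : Vec Bool f) → true) (allTuples f) ≡ 2 ^ f
count-all zero = refl
count-all (suc f) = trans (sumL-allTuples-suc f (λ _ → 1))
  (trans (cong₂ _+_ (count-all f) (count-all f)) (cong (_+_ (2 ^ f)) (sym (+-identityʳ (2 ^ f)))))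

count-ones : ∀ f i → count (λ (v : Vec Bool f) → ones v ≡ᵇ i) (allTuples f) ≡ f C i
count-ones zero zero = refl
count-ones zero (suc i) = refl
count-ones (suc f) zero = trans (sumL-allTuples-suc f _)
  (cong₂ _+_ (sumL-zero (allTuples f)) (count-ones f 0))
count-ones (suc f) (suc i) = trans (sumL-allTuples-suc f _)
  (trans (cong₂ _+_ (count-ones f i) (count-ones f (suc i))) (nCk+nC[k+1]≡[n+1]C[k+1] f i))

binomHalf-even : ∀ a i → binomHalf a (i + i) ≡ a C i
binomHalf-even a i =
  trans (cong (λ x → if x ≡ᵇ 0 then a C ((i + i) / 2) else 0) (double-even i)) (cong (a C_) (double-half i))

binomHalf-odd : ∀ a i → binomHalf a (suc (i + i)) ≡ 0
binomHalf-odd a i = cong (λ x → if x ≡ᵇ 0 then a C (suc (i + i) / 2) else 0)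
  (trans (cong (_% 2) (cong suc (double≡*2 i))) ([m+kn]%n≡m%n 1 i 2))

double-≡ᵇ-even : ∀ o i → (o + o ≡ᵇ i + i) ≡ (o ≡ᵇ i)
double-≡ᵇ-even zero zero = refl
double-≡ᵇ-even zero (suc i) = refl
double-≡ᵇ-even (suc o) zero = refl
double-≡ᵇ-even (suc o) (suc i) rewrite +-suc o o | +-suc i i = double-≡ᵇ-even o i

double-≡ᵇ-odd : ∀ o i → (o + o ≡ᵇ suc (i + i)) ≡ false
double-≡ᵇ-odd zero i = refl
double-≡ᵇ-odd (suc o) zero rewrite +-suc o o = refl
double-≡ᵇ-odd (suc o) (suc i) rewrite +-suc o o | +-suc i i = double-≡ᵇ-odd o i

count-double-ones : ∀ f m → count (λ (v : Vec Bool f) → ones v + ones v ≡ᵇ m) (allTuples f) ≡ binomHalf f m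
count-double-ones f m with parity m
... | inj₁ (i , refl) = trans (sumL-cong (allTuples f) (λ v → cong indicator (double-≡ᵇ-even (ones v) i)))
                          (trans (count-ones f i) (sym (binomHalf-even f i)))
... | inj₂ (i , refl) = trans (sumL-cong (allTuples f) (λ v → cong indicator (double-≡ᵇ-odd (ones v) i)))
                          (trans (sumL-zero (allTuples f)) (sym (binomHalf-odd f i)))

binomHalf-small : ∀ a m → a ≤ 1 → 3 ≤ m → binomHalf a m ≡ 0
binomHalf-small a m a≤1 3≤m with parity m
... | inj₂ (i , refl) = binomHalf-odd a i
... | inj₁ (i , refl) = trans (binomHalf-even a i) (k>n⇒nCk≡0 (≤-<-trans a≤1 2≤i))
  where
  2≤i : 2 ≤ i
  2≤i = ≮⇒≥ λ i<2 → <-irrefl refl (≤-<-trans 3≤m (small i<2))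
    where
    small : i < 2 → i + i < 3
    small (s≤s z≤n) = s≤s z≤n
    small (s≤s (s≤s z≤n)) = s≤s (s≤s (s≤s z≤n))

-- Total lookup by a natural-number position (false outside the tuple); all
-- positional reasoning is done through lk, and entry reduces to it modulo n.
lk : ∀ {m} → Vec Bool m → ℕ → Bool
lk [] _ = false
lk (x ∷ v) zero = x
lk (x ∷ v) (suc i) = lk v i

lookup≡lk : ∀ {m} (v : Vec Bool m) i (i<m : i < m) → lookup v (fromℕ< i<m) ≡ lk v i
lookup≡lk (x ∷ v) zero _ = refl
lookup≡lk (x ∷ v) (suc i) (s≤s i<m) = lookup≡lk v i i<m

entry≡lk : ∀ {M} (v : Vec Bool (suc M)) j → entry v j ≡ lk v (j % suc M)
entry≡lk {M} v j = lookup≡lk v (j % suc M) (m%n<n j (suc M))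

entry-cong-mod : ∀ {M} (v : Vec Bool (suc M)) x y → x % suc M ≡ y % suc M → entry v x ≡ entry v y
entry-cong-mod v x y h = trans (entry≡lk v x) (trans (cong (lk v) h) (sym (entry≡lk v y)))

entry-below : ∀ {M} (v : Vec Bool (suc M)) y → y < suc M → entry v y ≡ lk v y
entry-below v y y<n = trans (entry≡lk v y) (cong (lk v) (m<n⇒m%n≡m y<n))

entry-periodic : ∀ {M} (v : Vec Bool (suc M)) y → entry v (y + suc M) ≡ entry v y
entry-periodic {M} v y = entry-cong-mod v (y + suc M) y ([m+n]%n≡m%n y (suc M))

entry-reduce : ∀ {M} (v : Vec Bool (suc M)) y → entry v (y % suc M) ≡ entry v y
entry-reduce {M} v y = entry-cong-mod v (y % suc M) y (m%n%n≡m%n y (suc M))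

lk-ext : ∀ {m} (u v : Vec Bool m) → (∀ i → i < m → lk u i ≡ lk v i) → u ≡ v
lk-ext [] [] h = refl
lk-ext (x ∷ u) (y ∷ v) h = cong₂ _∷_ (h 0 (s≤s z≤n)) (lk-ext u v (λ i i<m → h (suc i) (s≤s i<m)))

build : (ℕ → Bool) → (m : ℕ) → Vec Bool m
build w zero = []
build w (suc m) = w 0 ∷ build (w ∘ suc) m

lk-build : ∀ w m i → i < m → lk (build w m) i ≡ w i
lk-build w (suc m) zero _ = refl
lk-build w (suc m) (suc i) (s≤s i<m) = lk-build (w ∘ suc) m i i<m

lk-∷ʳ-< : ∀ {m} (v : Vec Bool m) x i → i < m → lk (v ∷ʳ x) i ≡ lk v i
lk-∷ʳ-< (y ∷ v) x zero _ = refl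
lk-∷ʳ-< (y ∷ v) x (suc i) (s≤s i<m) = lk-∷ʳ-< v x i i<m

lk-∷ʳ-last : ∀ {m} (v : Vec Bool m) x → lk (v ∷ʳ x) m ≡ x
lk-∷ʳ-last [] x = refl
lk-∷ʳ-last (y ∷ v) x = lk-∷ʳ-last v x

lk-++ˡ : ∀ {m n} (u : Vec Bool m) (v : Vec Bool n) i → i < m → lk (u V.++ v) i ≡ lk u i
lk-++ˡ (x ∷ u) v zero _ = refl
lk-++ˡ (x ∷ u) v (suc i) (s≤s i<m) = lk-++ˡ u v i i<m

lk-++ʳ : ∀ {m n} (u : Vec Bool m) (v : Vec Bool n) i → lk (u V.++ v) (m + i) ≡ lk v i
lk-++ʳ [] v i = refl
lk-++ʳ (x ∷ u) v i = lk-++ʳ u v i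

lk-reverse : ∀ {m} (v : Vec Bool m) i j → i + suc j ≡ m → lk (V.reverse v) i ≡ lk v j
lk-reverse [] i j h = ⊥-elim (0≢1+n (sym (trans (sym (+-suc i j)) h)))
lk-reverse (x ∷ v) i zero h rewrite reverse-∷ x v | +-suc i 0 | +-identityʳ i | suc-injective h =
  lk-∷ʳ-last (V.reverse v) x
lk-reverse {suc m} (x ∷ v) i (suc j) h rewrite reverse-∷ x v =
  trans (lk-∷ʳ-< (V.reverse v) x i (from-difference j i+j+1≡m)) (lk-reverse v i j (trans (+-suc i j) i+j+1≡m))
  where
  i+j+1≡m : suc i + j ≡ m
  i+j+1≡m = suc-injective (trans (cong suc (sym (+-suc i j))) (trans (sym (+-suc i (suc j))) h))

rot : ∀ {m} → Vec Bool m → Vec Bool m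
rot [] = []
rot (x ∷ v) = v ∷ʳ x

rots : ∀ {m} → ℕ → Vec Bool m → Vec Bool m
rots zero v = v
rots (suc d) v = rots d (rot v)

entry-rot : ∀ {M} (v : Vec Bool (suc M)) j → entry (rot v) j ≡ entry v (suc j)
entry-rot {M} (x ∷ v) j with m≤n⇒m<n∨m≡n (s≤s⁻¹ (m%n<n j (suc M)))
... | inj₁ i<M = begin
    entry (v ∷ʳ x) j                 ≡⟨ entry≡lk (v ∷ʳ x) j ⟩
    lk (v ∷ʳ x) (j % suc M)          ≡⟨ lk-∷ʳ-< v x _ i<M ⟩
    lk (x ∷ v) (suc (j % suc M))     ≡⟨ cong (lk (x ∷ v)) (sym (m<n⇒m%n≡m (s≤s i<M))) ⟩
    lk (x ∷ v) (suc (j % suc M) % suc M) ≡⟨ cong (lk (x ∷ v)) (sym (suc-mod j)) ⟩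
    lk (x ∷ v) (suc j % suc M)       ≡⟨ sym (entry≡lk (x ∷ v) (suc j)) ⟩
    entry (x ∷ v) (suc j)            ∎
  where
  open ≡-Reasoning
  suc-mod : ∀ j → suc j % suc M ≡ suc (j % suc M) % suc M
  suc-mod j = mod-from-multiples {suc M} (suc j) (suc (j % suc M)) 0 (j / suc M)
    (trans (+-identityʳ (suc j)) (cong suc (m≡m%n+[m/n]*n j (suc M))))
... | inj₂ i≡M = begin
    entry (v ∷ʳ x) j                 ≡⟨ entry≡lk (v ∷ʳ x) j ⟩
    lk (v ∷ʳ x) (j % suc M)          ≡⟨ cong (lk (v ∷ʳ x)) i≡M ⟩
    lk (v ∷ʳ x) M                    ≡⟨ lk-∷ʳ-last v x ⟩
    lk (x ∷ v) 0                     ≡⟨ cong (lk (x ∷ v)) (sym suc-j%n≡0) ⟩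
    lk (x ∷ v) (suc j % suc M)       ≡⟨ sym (entry≡lk (x ∷ v) (suc j)) ⟩
    entry (x ∷ v) (suc j)            ∎
  where
  open ≡-Reasoning
  suc-j%n≡0 : suc j % suc M ≡ 0
  suc-j%n≡0 = trans (mod-from-multiples {suc M} (suc j) (suc M) 0 (j / suc M)
      (trans (+-identityʳ (suc j)) (cong suc (trans (m≡m%n+[m/n]*n j (suc M)) (cong (_+ (j / suc M) * suc M) i≡M)))))
    (n%n≡0 (suc M))

entry-rots : ∀ {M} d (v : Vec Bool (suc M)) j → entry (rots d v) j ≡ entry v (j + d)
entry-rots zero v j = cong (entry v) (sym (+-identityʳ j))
entry-rots (suc d) v j =
  trans (entry-rots d (rot v) j) (trans (entry-rot v (j + d)) (cong (entry v) (sym (+-suc j d))))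

ones-∷ : ∀ {m} x (v : Vec Bool m) → ones (x ∷ v) ≡ indicator x + ones v
ones-∷ true v = refl
ones-∷ false v = refl

ones-∷ʳ : ∀ {m} (v : Vec Bool m) x → ones (v ∷ʳ x) ≡ ones v + indicator x
ones-∷ʳ [] x = trans (ones-∷ x []) (+-comm (indicator x) 0)
ones-∷ʳ (y ∷ v) x = trans (ones-∷ y (v ∷ʳ x))
  (trans (cong (_+_ (indicator y)) (ones-∷ʳ v x))
    (trans (sym (+-assoc (indicator y) (ones v) (indicator x))) (cong (_+ indicator x) (sym (ones-∷ y v)))))

ones-++ : ∀ {m n} (u : Vec Bool m) (v : Vec Bool n) → ones (u V.++ v) ≡ ones u + ones v
ones-++ [] v = refl
ones-++ (true ∷ u) v = cong suc (ones-++ u v)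
ones-++ (false ∷ u) v = ones-++ u v

ones-reverse : ∀ {m} (v : Vec Bool m) → ones (V.reverse v) ≡ ones v
ones-reverse [] = refl
ones-reverse (x ∷ v) rewrite reverse-∷ x v = begin
  ones (V.reverse v ∷ʳ x)          ≡⟨ ones-∷ʳ (V.reverse v) x ⟩
  ones (V.reverse v) + indicator x ≡⟨ cong (_+ indicator x) (ones-reverse v) ⟩
  ones v + indicator x             ≡⟨ +-comm (ones v) (indicator x) ⟩
  indicator x + ones v             ≡⟨ sym (ones-∷ x v) ⟩
  ones (x ∷ v)                     ∎
  where open ≡-Reasoning

ones-rots : ∀ {m} d (v : Vec Bool m) → ones (rots d v) ≡ ones v
ones-rots zero v = refl
ones-rots (suc d) v = trans (ones-rots d (rot v)) (ones-rot v)
  where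
  ones-rot : ∀ {m} (v : Vec Bool m) → ones (rot v) ≡ ones v
  ones-rot [] = refl
  ones-rot (x ∷ v) = trans (ones-∷ʳ v x) (trans (+-comm (ones v) (indicator x)) (sym (ones-∷ x v)))

not-true : ∀ {x} → not x ≡ true → x ≡ false
not-true {false} _ = refl

not-false : ∀ {x} → x ≡ false → not x ≡ true
not-false refl = refl

∧-intro : ∀ {x y} → x ≡ true → y ≡ true → x ∧ y ≡ true
∧-intro refl refl = refl

∨-elim : ∀ {x y} → x ∨ y ≡ true → x ≡ true ⊎ y ≡ true
∨-elim {true} _ = inj₁ refl
∨-elim {false} h = inj₂ h

∨-introˡ : ∀ {x} y → x ≡ true → x ∨ y ≡ true
∨-introˡ y refl = refl

∨-introʳ : ∀ x {y} → y ≡ true → x ∨ y ≡ true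
∨-introʳ true _ = refl
∨-introʳ false h = h

true≢false : true ≢ false
true≢false ()

T⇒≡true : ∀ {b} → T b → b ≡ true
T⇒≡true {true} _ = refl

<ᵇ-true : ∀ {m n} → m < n → (m <ᵇ n) ≡ true
<ᵇ-true m<n = T⇒≡true (<⇒<ᵇ m<n)

≤ᵇ-true : ∀ {m n} → m ≤ n → (m ≤ᵇ n) ≡ true
≤ᵇ-true m≤n = T⇒≡true (≤⇒≤ᵇ m≤n)

beq-refl : ∀ x → beq x x ≡ true
beq-refl true = refl
beq-refl false = refl

beq-sound : ∀ {x y} → beq x y ≡ true → x ≡ y
beq-sound {true} {true} _ = refl
beq-sound {false} {false} _ = refl

allBelow-elim : ∀ b p → allBelow b p ≡ true → ∀ i → i < b → p i ≡ true
allBelow-elim (suc b) p h i i<b+1 with m≤n⇒m<n∨m≡n (s≤s⁻¹ i<b+1)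
... | inj₁ i<b = allBelow-elim b p (∧-conicalˡ (allBelow b p) (p b) h) i i<b
... | inj₂ refl = ∧-conicalʳ (allBelow i p) (p i) h

allBelow-intro : ∀ b p → (∀ i → i < b → p i ≡ true) → allBelow b p ≡ true
allBelow-intro zero p h = refl
allBelow-intro (suc b) p h = ∧-intro (allBelow-intro b p (λ i i<b → h i (m<n⇒m<1+n i<b))) (h b (n<1+n b))

anyBelow-elim : ∀ b p → anyBelow b p ≡ true → ∃ λ i → i < b × p i ≡ true
anyBelow-elim (suc b) p h with ∨-elim {anyBelow b p} h
... | inj₁ h′ = let (i , i<b , pi) = anyBelow-elim b p h′ in i , m<n⇒m<1+n i<b , pi
... | inj₂ pb = b , n<1+n b , pb

anyBelow-intro : ∀ b p i → i < b → p i ≡ true → anyBelow b p ≡ true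
anyBelow-intro (suc b) p i i<b+1 pi with m≤n⇒m<n∨m≡n (s≤s⁻¹ i<b+1)
... | inj₁ i<b = ∨-introˡ (p b) (anyBelow-intro b p i i<b pi)
... | inj₂ refl = ∨-introʳ (anyBelow i p) pi

ZeroWindow : ∀ {n} → Vec Bool n → ℕ → ℕ → Set
ZeroWindow a L s = ∀ j → j < L → entry a (s + j) ≡ false

window-reduce : ∀ {M} (a : Vec Bool (suc M)) {L s} → ZeroWindow a L s → ZeroWindow a L (s % suc M)
window-reduce {M} a {s = s} window j j<L = trans (entry-cong-mod a (s % suc M + j) (s + j) (%-absorbˡ s j (suc M))) (window j j<L)

badBlock⇒window : ∀ {n} (a : Vec Bool n) → hasBadBlock a ≡ true → ∃ λ s → ZeroWindow a (badLength n) s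
badBlock⇒window {n} a h =
  let (s , _ , hs) = anyBelow-elim n _ h
      (l , _ , hl) = anyBelow-elim n _ hs
      bl≤l = ≤ᵇ⇒≤ (badLength n) l (subst T (sym (∧-conicalˡ (badLength n ≤ᵇ l) _ hl)) _)
      zeros = allBelow-elim l _ (∧-conicalˡ _ _ (∧-conicalʳ (badLength n ≤ᵇ l) _ hl))
  in s , λ j j<bl → not-true (zeros j (<-≤-trans j<bl bl≤l))

run⇒badBlock : ∀ {M} (a : Vec Bool (suc M)) z l → badLength (suc M) ≤ l → l < suc M →
  entry a z ≡ true → (∀ j → j < l → entry a (suc z + j) ≡ false) → entry a (suc z + l) ≡ true →
  hasBadBlock a ≡ true
run⇒badBlock {M} a z l bl≤l l<n one-before zeros one-after =
  anyBelow-intro (suc M) _ start (m%n<n (suc z) (suc M))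
    (anyBelow-intro (suc M) _ l l<n
      (∧-intro (≤ᵇ-true bl≤l)
        (∧-intro (allBelow-intro l _ (λ j j<l → not-false (trans (from-start j) (zeros j j<l))))
          (∧-intro left-end (trans (from-start l) one-after)))))
  where
  start = suc z % suc M
  from-start : ∀ j → entry a (start + j) ≡ entry a (suc z + j)
  from-start j = entry-cong-mod a (start + j) (suc z + j) (%-absorbˡ (suc z) j (suc M))
  left-end : entry a (start + suc M ∸ 1) ≡ true
  left-end = trans (cong (λ x → entry a (x ∸ 1)) (+-suc start M))
    (trans (from-start M) (trans (cong (entry a) (sym (+-suc z M))) (trans (entry-periodic a z) one-before)))

last-true : (w : ℕ → Bool) (s z0 : ℕ) → z0 < s → w z0 ≡ true →
  ∃ λ z → z < s × w z ≡ true × (∀ y → z < y → y < s → w y ≡ false)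
last-true w (suc s) z0 z0<s+1 wz0 with w s in ws
... | true = s , n<1+n s , ws , λ y s<y y<s+1 → ⊥-elim (<-irrefl refl (<-≤-trans s<y (s≤s⁻¹ y<s+1)))
... | false with m≤n⇒m<n∨m≡n (s≤s⁻¹ z0<s+1)
...   | inj₂ refl = ⊥-elim (true≢false (trans (sym wz0) ws))
...   | inj₁ z0<s =
  let (z , z<s , wz , after-z) = last-true w s z0 z0<s wz0 in
  z , m<n⇒m<1+n z<s , wz , λ y z<y y<s+1 → [ after-z y z<y , (λ { refl → ws }) ]′ (m≤n⇒m<n∨m≡n (s≤s⁻¹ y<s+1))

first-true : (w : ℕ → Bool) (lo f : ℕ) → w (lo + f) ≡ true →
  ∃ λ e → lo ≤ e × e ≤ lo + f × w e ≡ true × (∀ y → lo ≤ y → y < e → w y ≡ false)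
first-true w lo f wf with w lo in wlo
... | true = lo , ≤-refl , m≤m+n lo f , wlo , λ y lo≤y y<lo → ⊥-elim (<-irrefl refl (<-≤-trans y<lo lo≤y))
first-true w lo zero wf | false = ⊥-elim (true≢false (trans (sym wf) (trans (cong w (+-identityʳ lo)) wlo)))
first-true w lo (suc f) wf | false =
  let (e , lo<e , e≤ , we , before-e) = first-true w (suc lo) f (trans (cong w (sym (+-suc lo f))) wf) in
  e , <⇒≤ lo<e , subst (e ≤_) (sym (+-suc lo f)) e≤ , we ,
  λ y lo≤y y<e → [ (λ lo<y → before-e y lo<y y<e) , (λ { refl → wlo }) ]′ (m≤n⇒m<n∨m≡n lo≤y)

-- Zeros between a one at z and a zero window starting at s > z continue up to the
-- first one e after the window, which comes at the latest at the copy z + n of z.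
zeros-up-to-next-one : ∀ {M} (a : Vec Bool (suc M)) z L s → z < s → entry a z ≡ true →
  (∀ y → z < y → y < s → entry a y ≡ false) → ZeroWindow a L s →
  ∃ λ e → s + L ≤ e × e ≤ z + suc M × entry a e ≡ true × (∀ y → z < y → y < e → entry a y ≡ false)
zeros-up-to-next-one {M} a z L s z<s one-at-z zeros-before window =
  let (f , end+f≡z+n) = difference window-end≤z+n
      (e , end≤e , e≤ , one-at-e , zeros-from-end) =
        first-true (entry a) (s + L) f (trans (cong (entry a) end+f≡z+n) one-at-z+n)
  in e , end≤e , subst (e ≤_) end+f≡z+n e≤ , one-at-e , λ y z<y y<e → zero-at y z<y (λ end≤y → zeros-from-end y end≤y y<e)
  where
  one-at-z+n : entry a (z + suc M) ≡ true
  one-at-z+n = trans (entry-periodic a z) one-at-z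
  in-window : ∀ {y} → s ≤ y → y < s + L → entry a y ≡ false
  in-window {y} s≤y y<end = let (i , s+i≡y) = difference s≤y in
    trans (cong (entry a) (sym s+i≡y)) (window i (+-cancelˡ-< s i L (subst (_< s + L) (sym s+i≡y) y<end)))
  zero-at : ∀ y → z < y → (s + L ≤ y → entry a y ≡ false) → entry a y ≡ false
  zero-at y z<y after-window with y <? s
  ... | yes y<s = zeros-before y z<y y<s
  ... | no y≮s with y <? s + L
  ...   | yes y<end = in-window (≮⇒≥ y≮s) y<end
  ...   | no y≮end = after-window (≮⇒≥ y≮end)
  window-end≤z+n : s + L ≤ z + suc M
  window-end≤z+n = ≮⇒≥ λ z+n<end → true≢false (trans (sym one-at-z+n)
    (zero-at (z + suc M) (m<m+n z (s≤s z≤n)) (λ end≤z+n → ⊥-elim (<-irrefl refl (<-≤-trans z+n<end end≤z+n)))))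

-- A zero window of length L ≥ badLength n, preceded by a one at z with only zeros in
-- between, extends to a bad block: the run of zeros from z + 1 to the next one e.
framed-window⇒badBlock : ∀ {M} (a : Vec Bool (suc M)) z L s → badLength (suc M) ≤ L →
  z < s → entry a z ≡ true → (∀ y → z < y → y < s → entry a y ≡ false) → ZeroWindow a L s →
  hasBadBlock a ≡ true
framed-window⇒badBlock {M} a z L s bl≤L z<s one-at-z zeros-before window =
  let (e , end≤e , e≤z+n , one-at-e , zeros) = zeros-up-to-next-one a z L s z<s one-at-z zeros-before window
      (l , z+1+l≡e) = difference (≤-trans z<s (≤-trans (m≤m+n s L) end≤e))
      L≤l = +-cancelˡ-≤ (suc z) L l (≤-trans (+-monoˡ-≤ L z<s) (subst (s + L ≤_) (sym z+1+l≡e) end≤e))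
      l<n = s≤s (+-cancelˡ-≤ z l M (s≤s⁻¹ (subst (suc z + l ≤_) (+-suc z M) (subst (_≤ z + suc M) (sym z+1+l≡e) e≤z+n))))
  in run⇒badBlock a z l (≤-trans bl≤L L≤l) l<n one-at-z
       (λ j j<l → zeros (suc z + j) (s≤s (m≤m+n z j)) (subst (suc z + j <_) z+1+l≡e (+-monoʳ-< (suc z) j<l)))
       (trans (cong (entry a) z+1+l≡e) one-at-e)

-- The window is moved one period to the right so
-- that the one at i0 (reduced mod n) lies before it; the last such one frames it.
window⇒badBlock : ∀ {M} (a : Vec Bool (suc M)) i0 L s → entry a i0 ≡ true →
  ZeroWindow a L s → badLength (suc M) ≤ L → hasBadBlock a ≡ true
window⇒badBlock {M} a i0 L s one window bl≤L =
  let (z , z<s′ , one-at-z , zeros-before) =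
        last-true (entry a) (s + suc M) (i0 % suc M) (<-≤-trans (m%n<n i0 (suc M)) (m≤n+m (suc M) s))
                  (trans (entry-reduce a i0) one)
  in framed-window⇒badBlock a z L (s + suc M) bl≤L z<s′ one-at-z zeros-before shifted-window
  where
  shifted-window : ZeroWindow a L (s + suc M)
  shifted-window j j<L = trans (cong (entry a) (+-swap-last s (suc M) j)) (trans (entry-periodic a (s + j)) (window j j<L))

badLength-double : ∀ k′ → badLength (suc k′ + suc k′) ≡ k′
badLength-double k′ =
  trans (cong (λ x → if x ≡ᵇ 0 then N / 2 ∸ 1 else N / 2) (double-even (suc k′))) (cong (_∸ 1) (double-half (suc k′)))
  where N = suc k′ + suc k′

ones≡0⇒no-one : ∀ {m} (v : Vec Bool m) → ones v ≡ 0 → ∀ i → lk v i ≡ false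
ones≡0⇒no-one [] _ i = refl
ones≡0⇒no-one (false ∷ v) h zero = refl
ones≡0⇒no-one (false ∷ v) h (suc i) = ones≡0⇒no-one v h i

ones≢0⇒one : ∀ {m} (v : Vec Bool m) → ones v ≢ 0 → ∃ λ i → i < m × lk v i ≡ true
ones≢0⇒one [] h = ⊥-elim (h refl)
ones≢0⇒one (true ∷ v) h = 0 , s≤s z≤n , refl
ones≢0⇒one (false ∷ v) h = let (i , i<m , one) = ones≢0⇒one v h in suc i , s≤s i<m , one

ones≡0⇒allZero : ∀ {M} (a : Vec Bool (suc M)) → ones a ≡ 0 → allZero a ≡ true
ones≡0⇒allZero {M} a h = allBelow-intro (suc M) _
  (λ i i<n → not-false (trans (entry-below a i i<n) (ones≡0⇒no-one a h i)))

one⇒¬allZero : ∀ {M} (a : Vec Bool (suc M)) i → entry a i ≡ true → allZero a ≡ false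
one⇒¬allZero {M} a i one with allZero a in all-zero
... | false = refl
... | true = ⊥-elim (true≢false (trans (sym one) (trans (sym (entry-reduce a i))
               (not-true (allBelow-elim (suc M) _ all-zero (i % suc M) (m%n<n i (suc M)))))))

zeroOn : ∀ {m} → (ℕ → Bool) → Vec Bool m → Bool
zeroOn S [] = true
zeroOn S (x ∷ v) = (not x ∨ not (S 0)) ∧ zeroOn (S ∘ suc) v

zeroOn-elim : ∀ {m} S (b : Vec Bool m) → zeroOn S b ≡ true → ∀ t → t < m → S t ≡ true → lk b t ≡ false
zeroOn-elim S (false ∷ b) h zero _ _ = refl
zeroOn-elim S (true ∷ b) h zero _ st rewrite st = ⊥-elim (true≢false (sym h))
zeroOn-elim S (x ∷ b) h (suc t) (s≤s t<m) st =
  zeroOn-elim (S ∘ suc) b (∧-conicalʳ (not x ∨ not (S 0)) _ h) t t<m st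

zeroOn-intro : ∀ {m} S (b : Vec Bool m) → (∀ t → t < m → S t ≡ true → lk b t ≡ false) → zeroOn S b ≡ true
zeroOn-intro S [] h = refl
zeroOn-intro S (x ∷ b) h = ∧-intro (head-ok x refl) (zeroOn-intro (S ∘ suc) b (λ t t<m st → h (suc t) (s≤s t<m) st))
  where
  head-ok : ∀ y → y ≡ x → not y ∨ not (S 0) ≡ true
  head-ok false _ = refl
  head-ok true y≡x with S 0 in s0
  ... | false = refl
  ... | true = ⊥-elim (true≢false (trans y≡x (h 0 (s≤s z≤n) s0)))

zeroOn-∪ : ∀ {m} S S′ (b : Vec Bool m) → zeroOn S b ∧ zeroOn S′ b ≡ zeroOn (λ t → S t ∨ S′ t) b
zeroOn-∪ S S′ [] = refl
zeroOn-∪ S S′ (x ∷ b) =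
  trans (head x (S 0) (S′ 0) (zeroOn (S ∘ suc) b) (zeroOn (S′ ∘ suc) b))
    (cong (_∧_ (not x ∨ not (S 0 ∨ S′ 0))) (zeroOn-∪ (S ∘ suc) (S′ ∘ suc) b))
  where
  head : ∀ x s s′ Z Z′ → ((not x ∨ not s) ∧ Z) ∧ ((not x ∨ not s′) ∧ Z′) ≡ (not x ∨ not (s ∨ s′)) ∧ (Z ∧ Z′)
  head false s s′ Z Z′ = refl
  head true true s′ Z Z′ = refl
  head true false true Z Z′ = ∧-zeroʳ Z
  head true false false Z Z′ = refl

free : ℕ → (ℕ → Bool) → ℕ
free zero S = 0
free (suc k) S = indicator (not (S 0)) + free k (S ∘ suc)

free-cong : ∀ k {S S′ : ℕ → Bool} → (∀ t → S t ≡ S′ t) → free k S ≡ free k S′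
free-cong zero h = refl
free-cong (suc k) h = cong₂ _+_ (cong (indicator ∘ not) (h 0)) (free-cong k (h ∘ suc))

-- Tuples vanishing on S are arbitrary on the free positions: for any condition h on
-- the number of ones, they are counted by the tuples of length free k S.
count-zeroOn : ∀ k S (h : ℕ → Bool) →
  count (λ b → zeroOn S b ∧ h (ones b)) (allTuples k) ≡ count (λ v → h (ones v)) (allTuples (free k S))
count-zeroOn zero S h = refl
count-zeroOn (suc k) S h = trans (sumL-allTuples-suc k _) (by-first-position (S 0) refl)
  where
  by-first-position : ∀ s → S 0 ≡ s →
    count (λ b → (not (S 0) ∧ zeroOn (S ∘ suc) b) ∧ h (suc (ones b))) (allTuples k)
      + count (λ b → zeroOn (S ∘ suc) b ∧ h (ones b)) (allTuples k)
    ≡ count (λ v → h (ones v)) (allTuples (free (suc k) S))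
  by-first-position true s0 rewrite s0 =
    cong₂ _+_ (sumL-zero (allTuples k)) (count-zeroOn k (S ∘ suc) h)
  by-first-position false s0 rewrite s0 =
    trans (cong₂ _+_ (count-zeroOn k (S ∘ suc) (h ∘ suc)) (count-zeroOn k (S ∘ suc) h))
      (sym (sumL-allTuples-suc (free k (S ∘ suc)) (λ v → indicator (h (ones v)))))

free-initial : ∀ k r → free k (_<ᵇ r) ≡ k ∸ r
free-initial zero r = sym (0∸n≡0 r)
free-initial (suc k) zero = cong suc (free-initial k 0)
free-initial (suc k) (suc r) = free-initial k r

<ᵇ-suc : ∀ c t → (c <ᵇ suc t) ≡ (c ≤ᵇ t)
<ᵇ-suc zero t = refl
<ᵇ-suc (suc c) t = refl

free-nothing : ∀ k → free k (λ _ → true) ≡ 0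
free-nothing zero = refl
free-nothing (suc k) = free-nothing k

free-final : ∀ k c → free k (c ≤ᵇ_) ≡ c ⊓ k
free-final zero zero = refl
free-final zero (suc c) = refl
free-final (suc k) zero = free-nothing k
free-final (suc k) (suc c) = cong suc (trans (free-cong k (<ᵇ-suc c)) (free-final k c))

free-both : ∀ k r c → free k (λ t → (t <ᵇ r) ∨ (c ≤ᵇ t)) ≡ (c ⊓ k) ∸ r
free-both k zero c = free-final k c
free-both zero (suc r) zero = refl
free-both zero (suc r) (suc c) = refl
free-both (suc k) (suc r) zero = trans (free-cong k (λ t → ∨-zeroʳ (t <ᵇ r))) (free-nothing k)
free-both (suc k) (suc r) (suc c) = trans (free-cong k (λ t → cong ((t <ᵇ r) ∨_) (<ᵇ-suc c t))) (free-both k r c)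

onesAtBothEnds : ∀ {k} → ℕ → ℕ → Vec Bool k → Bool
onesAtBothEnds r c b = not (zeroOn (_<ᵇ r) b) ∧ not (zeroOn (c ≤ᵇ_) b)

free-initial-of : ∀ r c → free (r + c) (_<ᵇ r) ≡ c
free-initial-of r c = trans (free-initial (r + c) r) (m+n∸m≡n r c)

free-final-of : ∀ r c → free (r + c) (c ≤ᵇ_) ≡ c
free-final-of r c = trans (free-final (r + c) c) (m≤n⇒m⊓n≡m (m≤n+m c r))

free-both-of : ∀ r c → free (r + c) (λ t → (t <ᵇ r) ∨ (c ≤ᵇ t)) ≡ c ∸ r
free-both-of r c = trans (free-both (r + c) r c) (cong (_∸ r) (m≤n⇒m⊓n≡m (m≤n+m c r)))

indicator-incl-excl : ∀ x y z → indicator ((not x ∧ not y) ∧ z) + indicator (x ∧ z) + indicator (y ∧ z)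
                               ≡ indicator z + indicator ((x ∧ y) ∧ z)
indicator-incl-excl true true true = refl
indicator-incl-excl true true false = refl
indicator-incl-excl true false true = refl
indicator-incl-excl true false false = refl
indicator-incl-excl false true true = refl
indicator-incl-excl false true false = refl
indicator-incl-excl false false true = refl
indicator-incl-excl false false false = refl

count-onesAtBothEnds : ∀ r c {k} → r + c ≡ k → (h : ℕ → Bool) →
  count (λ b → onesAtBothEnds r c b ∧ h (ones b)) (allTuples k)
    + count (λ v → h (ones v)) (allTuples c) + count (λ v → h (ones v)) (allTuples c)
  ≡ count (λ v → h (ones v)) (allTuples k) + count (λ v → h (ones v)) (allTuples (c ∸ r))
count-onesAtBothEnds r c refl h = begin
    count Both tuples + X c + X c
  ≡⟨ cong₂ (λ x y → count Both tuples + x + y) (sym (zero-count (_<ᵇ r) (free-initial-of r c))) (sym (zero-count (c ≤ᵇ_) (free-final-of r c))) ⟩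
    count Both tuples + count (Zero (_<ᵇ r)) tuples + count (Zero (c ≤ᵇ_)) tuples
  ≡⟨ trans (cong (_+ count (Zero (c ≤ᵇ_)) tuples) (sym (sumL-+ _ _ tuples))) (sym (sumL-+ _ _ tuples)) ⟩
    sumL (λ b → indicator (Both b) + indicator (Zero (_<ᵇ r) b) + indicator (Zero (c ≤ᵇ_) b)) tuples
  ≡⟨ sumL-cong tuples pointwise ⟩
    sumL (λ b → indicator (h (ones b)) + indicator (Zero (λ t → (t <ᵇ r) ∨ (c ≤ᵇ t)) b)) tuples
  ≡⟨ sumL-+ _ _ tuples ⟩
    X (r + c) + count (Zero (λ t → (t <ᵇ r) ∨ (c ≤ᵇ t))) tuples
  ≡⟨ cong (_+_ (X (r + c))) (zero-count (λ t → (t <ᵇ r) ∨ (c ≤ᵇ t)) (free-both-of r c)) ⟩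
    X (r + c) + X (c ∸ r) ∎
  where
  open ≡-Reasoning
  tuples = allTuples (r + c)
  X : ℕ → ℕ
  X f = count (λ v → h (ones v)) (allTuples f)
  Both : Vec Bool (r + c) → Bool
  Both b = onesAtBothEnds r c b ∧ h (ones b)
  Zero : (ℕ → Bool) → Vec Bool (r + c) → Bool
  Zero S b = zeroOn S b ∧ h (ones b)
  zero-count : ∀ S {f} → free (r + c) S ≡ f → count (Zero S) tuples ≡ X f
  zero-count S refl = count-zeroOn (r + c) S h
  -- A ∧ B is vanishing on the union of the two segments.
  pointwise : ∀ b → indicator (Both b) + indicator (Zero (_<ᵇ r) b) + indicator (Zero (c ≤ᵇ_) b)
                  ≡ indicator (h (ones b)) + indicator (Zero (λ t → (t <ᵇ r) ∨ (c ≤ᵇ t)) b)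
  pointwise b = trans (indicator-incl-excl (zeroOn (_<ᵇ r) b) (zeroOn (c ≤ᵇ_) b) (h (ones b)))
    (cong (λ z → indicator (h (ones b)) + indicator (z ∧ h (ones b))) (zeroOn-∪ (_<ᵇ r) (c ≤ᵇ_) b))

palindrome : ∀ {m} → Vec Bool m → Vec Bool (m + m)
palindrome b = b V.++ V.reverse b

palindrome-left : ∀ {M} (b : Vec Bool (suc M)) y → y < suc M → entry (palindrome b) y ≡ lk b y
palindrome-left {M} b y y<m = trans (entry-below (palindrome b) y (<-≤-trans y<m (m≤m+n (suc M) (suc M))))
  (lk-++ˡ b (V.reverse b) y y<m)

palindrome-right : ∀ {M} (b : Vec Bool (suc M)) t y → t + suc y ≡ suc M → entry (palindrome b) (suc M + t) ≡ lk b y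
palindrome-right {M} b t y t+y+1≡m =
  trans (entry-below (palindrome b) (suc M + t) (+-monoʳ-< (suc M) (from-difference y (trans (sym (+-suc t y)) t+y+1≡m))))
    (trans (lk-++ʳ b (V.reverse b) t) (lk-reverse b t y t+y+1≡m))


-- Two positions of the first period summing to 2m - 1 carry the same entry of the
-- palindrome: if Y is in the first half, the other is m + (m - 1 - Y).
palindrome-left-right : ∀ {M} (b : Vec Bool (suc M)) Y Y′ → Y < suc M → Y + Y′ + 1 ≡ suc M + suc M →
  entry (palindrome b) Y ≡ entry (palindrome b) Y′
palindrome-left-right {M} b Y Y′ Y<m sum = by-difference Y<m λ δ Y+1+δ≡m →
  trans (palindrome-left b Y Y<m) (sym (trans
    (cong (entry (palindrome b)) (linear {Y′} {suc M + δ} (cong₂ _+_ sum (sym Y+1+δ≡m)) (solve (atoms (Y ∷ Y′ ∷ δ ∷ M ∷ [])))))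
    (palindrome-right b δ Y (linear {δ + suc Y} {suc M} Y+1+δ≡m (solve (atoms (Y ∷ δ ∷ M ∷ [])))))))

palindrome-mirror-reduced : ∀ {M} (b : Vec Bool (suc M)) Y Y′ → Y + Y′ + 1 ≡ suc M + suc M →
  entry (palindrome b) Y ≡ entry (palindrome b) Y′
palindrome-mirror-reduced {M} b Y Y′ sum with Y <? suc M
... | yes Y<m = palindrome-left-right b Y Y′ Y<m sum
... | no Y≮m = sym (palindrome-left-right b Y′ Y (Y′<m (≮⇒≥ Y≮m)) (trans (cong (_+ 1) (+-comm Y′ Y)) sum))
  where
  Y′<m : suc M ≤ Y → Y′ < suc M
  Y′<m m≤Y = by-difference m≤Y λ t m+t≡Y →
    from-difference t (linear {suc Y′ + t} {suc M} (cong₂ _+_ m+t≡Y sum) (solve (atoms (Y ∷ Y′ ∷ t ∷ M ∷ []))))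

palindrome-mirror : ∀ {M} (b : Vec Bool (suc M)) y y′ → (y + y′ + 1) % (suc M + suc M) ≡ 0 →
  entry (palindrome b) y ≡ entry (palindrome b) y′
palindrome-mirror {M} b y y′ h = begin
    entry (palindrome b) y         ≡⟨ sym (entry-reduce (palindrome b) y) ⟩
    entry (palindrome b) (y % N)   ≡⟨ palindrome-mirror-reduced b (y % N) (y′ % N) reduced-sum ⟩
    entry (palindrome b) (y′ % N)  ≡⟨ entry-reduce (palindrome b) y′ ⟩
    entry (palindrome b) y′        ∎
  where
  open ≡-Reasoning
  N = suc M + suc M
  regroup : ∀ Y Y′ u v N → Y + Y′ + 1 + (u + v) * N ≡ (Y + u * N) + (Y′ + v * N) + 1 + 0 * N
  regroup = solve-∀
  +-suc-suc : ∀ a b → suc (a + b + 1) ≡ suc a + suc b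
  +-suc-suc = solve-∀
  reduced-sum-mod : (y % N + y′ % N + 1) % N ≡ 0
  reduced-sum-mod = trans (mod-from-multiples {N} _ (y + y′ + 1) (y / N + y′ / N) 0
      (trans (regroup (y % N) (y′ % N) (y / N) (y′ / N) N)
        (cong₂ (λ u v → u + v + 1 + 0 * N) (sym (m≡m%n+[m/n]*n y N)) (sym (m≡m%n+[m/n]*n y′ N))))) h
  reduced-sum : y % N + y′ % N + 1 ≡ N
  reduced-sum = the-multiple-between {N} (y % N + y′ % N + 1) reduced-sum-mod
    (subst (0 <_) (sym (+-comm (y % N + y′ % N) 1)) (s≤s z≤n))
    (subst (_≤ N + N) (sym (+-suc-suc (y % N) (y′ % N))) (+-mono-≤ (m%n<n y N) (m%n<n y′ N)))

-- Zero windows of length k - 1 in the palindrome of a tuple b of length k = r + c,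
-- where c ∈ {r, r + 1}: such a window exists exactly when b vanishes on its first r
-- positions or on its last r positions (those ≥ c).  Each half of the palindrome
-- mirrors b, so a window covering k - 1 consecutive positions of the cycle of length
-- 2k sees one of these two end segments, directly or through the mirror.
module PalindromeWindows (k′ r c : ℕ) (split : r + c ≡ suc k′) (r≤c : r ≤ c) (c≤r+1 : c ≤ suc r) where

  overshoot<r : ∀ j j₂ → j < k′ → r + j₂ ≡ j → j₂ < r
  overshoot<r j j₂ j<k′ r+j₂≡j = by-difference j<k′ λ δ j+1+δ≡k′ → by-difference c≤r+1 λ e′ c+e′≡r+1 →
    from-difference (δ + e′) (linear {suc j₂ + (δ + e′)} {r}
      (cong₂ _+_ (cong₂ _+_ (cong₂ _+_ r+j₂≡j j+1+δ≡k′) (sym split)) c+e′≡r+1)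
      (solve (atoms (j ∷ j₂ ∷ δ ∷ e′ ∷ k′ ∷ r ∷ c ∷ []))))

  r≤k : r ≤ suc k′
  r≤k = from-difference c split

  -- If b vanishes on [0, r), the window starting at k + c is zero: it first runs
  -- over the mirror images of positions r - 1, …, 0 and then over the next copies
  -- of positions 0, 1, ….
  zero-start⇒window : ∀ b → zeroOn (_<ᵇ r) b ≡ true → ZeroWindow (palindrome b) k′ (suc k′ + c)
  zero-start⇒window b zero-start j j<k′ with j <? r
  ... | yes j<r = by-difference j<r λ δ j+1+δ≡r →
    let δ<r : δ < r
        δ<r = from-difference j (linear {suc δ + j} {r} j+1+δ≡r (solve (atoms (j ∷ δ ∷ r ∷ []))))
    in begin
      entry (palindrome b) (suc k′ + c + j)   ≡⟨ cong (entry (palindrome b)) (+-assoc (suc k′) c j) ⟩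
      entry (palindrome b) (suc k′ + (c + j)) ≡⟨ palindrome-right b (c + j) δ
                                                   (linear {c + j + suc δ} {suc k′} (cong₂ _+_ j+1+δ≡r split)
                                                     (solve (atoms (j ∷ δ ∷ c ∷ k′ ∷ r ∷ [])))) ⟩
      lk b δ                                  ≡⟨ zeroOn-elim (_<ᵇ r) b zero-start δ (<-≤-trans δ<r r≤k) (<ᵇ-true δ<r) ⟩
      false                                   ∎
    where open ≡-Reasoning
  ... | no j≮r = by-difference (≮⇒≥ j≮r) λ j₂ r+j₂≡j →
    let j₂<r = overshoot<r j j₂ j<k′ r+j₂≡j in
    begin
      entry (palindrome b) (suc k′ + c + j)          ≡⟨ cong (entry (palindrome b))
                                                          (linear {suc k′ + c + j} {j₂ + (suc k′ + suc k′)} (cong₂ _+_ (sym r+j₂≡j) split)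
                                                            (solve (atoms (j ∷ j₂ ∷ c ∷ k′ ∷ r ∷ [])))) ⟩
      entry (palindrome b) (j₂ + (suc k′ + suc k′))  ≡⟨ entry-periodic (palindrome b) j₂ ⟩
      entry (palindrome b) j₂                        ≡⟨ palindrome-left b j₂ (<-≤-trans j₂<r r≤k) ⟩
      lk b j₂                                        ≡⟨ zeroOn-elim (_<ᵇ r) b zero-start j₂ (<-≤-trans j₂<r r≤k) (<ᵇ-true j₂<r) ⟩
      false                                          ∎
    where open ≡-Reasoning

  -- If b vanishes on [c, k), the window starting at c is zero: it runs over the
  -- positions c, …, k - 1 and then over their mirror images.
  zero-end⇒window : ∀ b → zeroOn (c ≤ᵇ_) b ≡ true → ZeroWindow (palindrome b) k′ c
  zero-end⇒window b zero-end j j<k′ with j <? r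
  ... | yes j<r = by-difference j<r λ δ j+1+δ≡r →
    let c+j<k : c + j < suc k′
        c+j<k = from-difference δ (linear {suc (c + j) + δ} {suc k′} (cong₂ _+_ j+1+δ≡r split) (solve (atoms (j ∷ δ ∷ c ∷ k′ ∷ r ∷ []))))
    in trans (palindrome-left b (c + j) c+j<k) (zeroOn-elim (c ≤ᵇ_) b zero-end (c + j) c+j<k (≤ᵇ-true (m≤m+n c j)))
  ... | no j≮r = by-difference (≮⇒≥ j≮r) λ j₂ r+j₂≡j → by-difference (overshoot<r j j₂ j<k′ r+j₂≡j) λ δ j₂+1+δ≡r →
    let mirror-in-end : c + δ < suc k′
        mirror-in-end = from-difference j₂ (linear {suc (c + δ) + j₂} {suc k′} (cong₂ _+_ j₂+1+δ≡r split)
                          (solve (atoms (j₂ ∷ δ ∷ c ∷ k′ ∷ r ∷ []))))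
    in begin
      entry (palindrome b) (c + j)        ≡⟨ cong (entry (palindrome b)) (linear {c + j} {suc k′ + j₂} (cong₂ _+_ (sym r+j₂≡j) split)
                                               (solve (atoms (j ∷ j₂ ∷ c ∷ k′ ∷ r ∷ [])))) ⟩
      entry (palindrome b) (suc k′ + j₂)  ≡⟨ palindrome-right b j₂ (c + δ) (linear {j₂ + suc (c + δ)} {suc k′} (cong₂ _+_ j₂+1+δ≡r split)
                                               (solve (atoms (j₂ ∷ δ ∷ c ∷ k′ ∷ r ∷ [])))) ⟩
      lk b (c + δ)                        ≡⟨ zeroOn-elim (c ≤ᵇ_) b zero-end (c + δ) mirror-in-end (≤ᵇ-true (m≤m+n c δ)) ⟩
      false                               ∎
    where open ≡-Reasoning

  -- A window starting in [1, k] covers, for each position t ≥ c of b, either t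
  -- itself or its mirror image in the second half.
  early-window⇒zero-end : ∀ b s → 1 ≤ s → s ≤ suc k′ → ZeroWindow (palindrome b) k′ s → zeroOn (c ≤ᵇ_) b ≡ true
  early-window⇒zero-end b s 1≤s s≤k window = zeroOn-intro (c ≤ᵇ_) b λ t t<k c≤ᵇt →
    by-difference t<k λ δ t+1+δ≡k → by-difference (≤ᵇ⇒≤ c t (subst T (sym c≤ᵇt) _)) λ w c+w≡t → covered t δ w t<k t+1+δ≡k c+w≡t
    where
    covered : ∀ t δ w → t < suc k′ → suc t + δ ≡ suc k′ → c + w ≡ t → lk b t ≡ false
    covered t δ w t<k t+1+δ≡k c+w≡t with s ≤? t
    ... | yes s≤t = by-difference s≤t λ j s+j≡t → by-difference 1≤s λ s₀ 1+s₀≡s →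
      trans (sym (palindrome-left b t t<k)) (trans (cong (entry (palindrome b)) (sym s+j≡t))
        (window j (from-difference (δ + s₀) (linear {suc j + (δ + s₀)} {k′} (cong₂ _+_ (cong₂ _+_ s+j≡t t+1+δ≡k) 1+s₀≡s)
          (solve (atoms (j ∷ δ ∷ s₀ ∷ s ∷ t ∷ k′ ∷ [])))))))
    ... | no s≰t = by-difference s≤k λ g s+g≡k → by-difference r≤c λ v r+v≡c → by-difference (≰⇒> s≰t) λ x t+1+x≡s →
      trans (sym (palindrome-right b δ t (linear {δ + suc t} {suc k′} t+1+δ≡k (solve (atoms (t ∷ δ ∷ k′ ∷ []))))))
        (trans (cong (entry (palindrome b)) (sym (linear {s + (g + δ)} {suc k′ + δ} s+g≡k (solve (atoms (s ∷ g ∷ δ ∷ k′ ∷ []))))))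
          (window (g + δ) (from-difference (w + w + x + v) (linear {suc (g + δ) + (w + w + x + v)} {k′}
            (cong₂ _+_ (cong₂ _+_ (cong₂ _+_ (cong₂ _+_ (cong₂ _+_ (cong₂ _+_ s+g≡k t+1+δ≡k) c+w≡t) c+w≡t) r+v≡c) t+1+x≡s) (sym split))
            (solve (atoms (s ∷ g ∷ δ ∷ t ∷ w ∷ x ∷ v ∷ r ∷ c ∷ k′ ∷ [])))))))

  -- A window starting in [k + 1, 2k] covers, for each position t < r of b, either
  -- its mirror image in the second half or its next copy t + 2k.
  late-window⇒zero-start : ∀ b s → suc k′ < s → s ≤ suc k′ + suc k′ → ZeroWindow (palindrome b) k′ s → zeroOn (_<ᵇ r) b ≡ true
  late-window⇒zero-start b s k<s s≤2k window = zeroOn-intro (_<ᵇ r) b λ t t<k t<ᵇr →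
    by-difference t<k λ δ t+1+δ≡k → by-difference (<ᵇ⇒< t r (subst T (sym t<ᵇr) _)) λ z t+1+z≡r → covered t δ z t+1+δ≡k t+1+z≡r
    where
    covered : ∀ t δ z → suc t + δ ≡ suc k′ → suc t + z ≡ r → lk b t ≡ false
    covered t δ z t+1+δ≡k t+1+z≡r with s ≤? suc k′ + δ
    ... | yes s≤mirror = by-difference s≤mirror λ j s+j≡mirror → by-difference k<s λ x k+1+x≡s →
      trans (sym (palindrome-right b δ t (linear {δ + suc t} {suc k′} t+1+δ≡k (solve (atoms (t ∷ δ ∷ k′ ∷ []))))))
        (trans (cong (entry (palindrome b)) (sym s+j≡mirror))
          (window j (from-difference (x + t) (linear {suc j + (x + t)} {k′} (cong₂ _+_ (cong₂ _+_ s+j≡mirror k+1+x≡s) t+1+δ≡k)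
            (solve (atoms (s ∷ j ∷ x ∷ t ∷ δ ∷ k′ ∷ [])))))))
    ... | no s≰mirror = by-difference s≤2k λ g s+g≡2k → by-difference r≤c λ v r+v≡c → by-difference (≰⇒> s≰mirror) λ y mirror+1+y≡s →
      trans (sym (palindrome-left b t (<-≤-trans (from-difference z t+1+z≡r) r≤k)))
        (trans (sym (entry-periodic (palindrome b) t))
          (trans (cong (entry (palindrome b)) (sym (linear {s + (g + t)} {t + (suc k′ + suc k′)} s+g≡2k (solve (atoms (s ∷ g ∷ t ∷ k′ ∷ []))))))
            (window (g + t) (from-difference (z + z + v + y) (linear {suc (g + t) + (z + z + v + y)} {k′}
              (cong₂ _+_ (cong₂ _+_ (cong₂ _+_ (cong₂ _+_ (cong₂ _+_ (cong₂ _+_ s+g≡2k (sym t+1+δ≡k)) mirror+1+y≡s) t+1+z≡r) t+1+z≡r) r+v≡c) split)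
              (solve (atoms (s ∷ g ∷ t ∷ δ ∷ y ∷ z ∷ v ∷ r ∷ c ∷ k′ ∷ []))))))))

  -- Any zero window of length k - 1 forces one of the two end segments of b to vanish:
  -- reduce its start modulo 2k into [1, 2k] and apply the two previous lemmas.
  window⇒zero-start-or-end : ∀ b s → ZeroWindow (palindrome b) k′ s →
    zeroOn (_<ᵇ r) b ≡ true ⊎ zeroOn (c ≤ᵇ_) b ≡ true
  window⇒zero-start-or-end b s window =
    reduced (s % (suc k′ + suc k′)) (m%n<n s (suc k′ + suc k′)) (window-reduce (palindrome b) {k′} {s} window)
    where
    reduced : ∀ s₀ → s₀ < suc k′ + suc k′ → ZeroWindow (palindrome b) k′ s₀ →
      zeroOn (_<ᵇ r) b ≡ true ⊎ zeroOn (c ≤ᵇ_) b ≡ true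
    reduced zero _ window₀ = inj₁ (late-window⇒zero-start b (suc k′ + suc k′) (m<m+n (suc k′) (s≤s z≤n)) ≤-refl
      λ j j<k′ → trans (cong (entry (palindrome b)) (+-comm (suc k′ + suc k′) j))
        (trans (entry-periodic (palindrome b) j) (window₀ j j<k′)))
    reduced (suc s₀) s<2k window₀ with suc s₀ ≤? suc k′
    ... | yes s≤k = inj₂ (early-window⇒zero-end b (suc s₀) (s≤s z≤n) s≤k window₀)
    ... | no s≰k = inj₁ (late-window⇒zero-start b (suc s₀) (≰⇒> s≰k) (<⇒≤ s<2k) window₀)

-- Tuples of length 2k fixed by the reflection x ↦ q - x with q = 2p + 1 odd (which
-- has no fixed point) are exactly the rotations, by d = gap + k where p + 1 + gap = k,
-- of palindromes b ++ reverse b; the half b is read off at positions p + 1, …, p + k.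
-- Here k = k′ + 1.
module ReflectionFixed (k′ p gap : ℕ) (half : p + gap ≡ k′) where

  rotatedPalindrome : Vec Bool (suc k′) → Vec Bool (suc k′ + suc k′)
  rotatedPalindrome b = rots (gap + suc k′) (palindrome b)

  halfOf : Vec Bool (suc k′ + suc k′) → Vec Bool (suc k′)
  halfOf a = build (λ t → entry a (t + suc p)) (suc k′)

  rotated-entry : ∀ b j → entry (rotatedPalindrome b) j ≡ entry (palindrome b) (j + (gap + suc k′))
  rotated-entry b j = entry-rots (gap + suc k′) (palindrome b) j

  rotated-half : ∀ b t → t < suc k′ → entry (rotatedPalindrome b) (t + suc p) ≡ lk b t
  rotated-half b t t<k = begin
    entry (rotatedPalindrome b) (t + suc p)                ≡⟨ rotated-entry b (t + suc p) ⟩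
    entry (palindrome b) (t + suc p + (gap + suc k′))      ≡⟨ cong (entry (palindrome b))
                                                               (linear {t + suc p + (gap + suc k′)} {t + (suc k′ + suc k′)} half
                                                                 (solve (atoms (t ∷ p ∷ gap ∷ k′ ∷ [])))) ⟩
    entry (palindrome b) (t + (suc k′ + suc k′))           ≡⟨ entry-periodic (palindrome b) t ⟩
    entry (palindrome b) t                                 ≡⟨ palindrome-left b t t<k ⟩
    lk b t                                                 ∎
    where open ≡-Reasoning

  halfOf-rotated : ∀ b → halfOf (rotatedPalindrome b) ≡ b
  halfOf-rotated b = lk-ext (halfOf (rotatedPalindrome b)) b λ t t<k →
    trans (lk-build (λ t → entry (rotatedPalindrome b) (t + suc p)) (suc k′) t t<k) (rotated-half b t t<k)

  -- Positions z ≡ q - x (mod 2k) are mirror images for the palindrome once shifted by d.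
  mirror-sum : ∀ z x → z + x ≡ suc (p + p) + (suc k′ + suc k′) →
    z + (gap + suc k′) + (x + (gap + suc k′)) + 1 ≡ 3 * (suc k′ + suc k′)
  mirror-sum z x z+x≡q+2k = linear (cong₂ _+_ (cong₂ _+_ z+x≡q+2k half) half) (solve (atoms (z ∷ x ∷ p ∷ gap ∷ k′ ∷ [])))

  -- Rotating the palindrome moves its mirror axis onto that of x ↦ q - x.
  rotated-fixed : ∀ b → fixedByReflection (suc (p + p)) (rotatedPalindrome b) ≡ true
  rotated-fixed b = allBelow-intro (suc k′ + suc k′) _ λ x x<2k →
    subst (λ v → beq v (entry (rotatedPalindrome b) x) ≡ true) (sym (mirror x x<2k)) (beq-refl (entry (rotatedPalindrome b) x))
    where
    mirror : ∀ x → x < suc k′ + suc k′ →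
      entry (rotatedPalindrome b) (reflect (suc k′ + suc k′) (suc (p + p)) x) ≡ entry (rotatedPalindrome b) x
    mirror x x<2k = begin
      entry (rotatedPalindrome b) (z % (suc k′ + suc k′))   ≡⟨ entry-reduce (rotatedPalindrome b) z ⟩
      entry (rotatedPalindrome b) z                           ≡⟨ rotated-entry b z ⟩
      entry (palindrome b) (z + (gap + suc k′))               ≡⟨ palindrome-mirror b (z + (gap + suc k′)) (x + (gap + suc k′))
                                                                   (trans (cong (_% (suc k′ + suc k′)) sum) (m*n%n≡0 3 (suc k′ + suc k′))) ⟩
      entry (palindrome b) (x + (gap + suc k′))               ≡⟨ sym (rotated-entry b x) ⟩
      entry (rotatedPalindrome b) x                           ∎
      where
      open ≡-Reasoning
      z = suc (p + p) + (suc k′ + suc k′) ∸ x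
      sum : z + (gap + suc k′) + (x + (gap + suc k′)) + 1 ≡ 3 * (suc k′ + suc k′)
      sum = mirror-sum z x (m∸n+n≡m (≤-trans (<⇒≤ x<2k) (m≤n+m (suc k′ + suc k′) (suc (p + p)))))

  half-position : ∀ x Y Q → x + (gap + suc k′) ≡ Y + Q * (suc k′ + suc k′) →
    (Y + suc p) % (suc k′ + suc k′) ≡ x % (suc k′ + suc k′)
  half-position x Y Q x+d≡ = mod-from-multiples {suc k′ + suc k′} (Y + suc p) x Q 1
    (linear (cong₂ _+_ (sym x+d≡) half) (solve (atoms (x ∷ Y ∷ Q ∷ p ∷ gap ∷ k′ ∷ []))))

  mirror-position : ∀ x z Y Q t′ t → x + (gap + suc k′) ≡ Y + Q * (suc k′ + suc k′) →
    z + x ≡ suc (p + p) + (suc k′ + suc k′) → suc k′ + t′ ≡ Y → suc t′ + t ≡ suc k′ →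
    (t + suc p) % (suc k′ + suc k′) ≡ z % (suc k′ + suc k′)
  mirror-position x z Y Q t′ t x+d≡ z+x≡ k+t′≡Y t′+1+t≡k = mod-from-multiples {suc k′ + suc k′} (t + suc p) z 1 Q
    (linear (cong₂ _+_ (cong₂ _+_ (cong₂ _+_ (cong₂ _+_ x+d≡ (sym half)) (sym z+x≡)) (sym k+t′≡Y)) t′+1+t≡k)
      (solve (atoms (x ∷ z ∷ Y ∷ Q ∷ t′ ∷ t ∷ p ∷ gap ∷ k′ ∷ []))))

  -- In a fixed tuple, every entry equals an entry on the half: write x + d = Y + Q·2k
  -- with Y < 2k; for Y < k the position x is on the half, otherwise its mirror is.
  reaches-half : ∀ x → x < suc k′ + suc k′ → ∃ λ t → t < suc k′ ×
    (∀ w → fixedByReflection (suc (p + p)) w ≡ true → entry w x ≡ entry w (t + suc p))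
  reaches-half x x<2k = classify ((x + (gap + suc k′)) % (suc k′ + suc k′)) ((x + (gap + suc k′)) / (suc k′ + suc k′))
    (m≡m%n+[m/n]*n (x + (gap + suc k′)) (suc k′ + suc k′)) (m%n<n (x + (gap + suc k′)) (suc k′ + suc k′))
    where
    z = suc (p + p) + (suc k′ + suc k′) ∸ x
    z+x≡ : z + x ≡ suc (p + p) + (suc k′ + suc k′)
    z+x≡ = m∸n+n≡m (≤-trans (<⇒≤ x<2k) (m≤n+m (suc k′ + suc k′) (suc (p + p))))
    classify : ∀ Y Q → x + (gap + suc k′) ≡ Y + Q * (suc k′ + suc k′) → Y < suc k′ + suc k′ → ∃ λ t → t < suc k′ ×
      (∀ w → fixedByReflection (suc (p + p)) w ≡ true → entry w x ≡ entry w (t + suc p))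
    classify Y Q x+d≡ Y<2k with Y <? suc k′
    ... | yes Y<k = Y , Y<k , λ w _ → entry-cong-mod w x (Y + suc p) (sym (half-position x Y Q x+d≡))
    ... | no Y≮k = by-difference (≮⇒≥ Y≮k) λ t′ k+t′≡Y →
      by-difference (+-cancelˡ-< (suc k′) t′ (suc k′) (subst (_< suc k′ + suc k′) (sym k+t′≡Y) Y<2k)) λ t t′+1+t≡k →
      t , from-difference t′ (trans (cong suc (+-comm t t′)) t′+1+t≡k) , λ w fixed → begin
        entry w x                        ≡⟨ sym (beq-sound (allBelow-elim (suc k′ + suc k′) _ fixed x x<2k)) ⟩
        entry w (z % (suc k′ + suc k′))  ≡⟨ entry-reduce w z ⟩
        entry w z                        ≡⟨ entry-cong-mod w z (t + suc p) (sym (mirror-position x z Y Q t′ t x+d≡ z+x≡ k+t′≡Y t′+1+t≡k)) ⟩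
        entry w (t + suc p)              ∎
      where open ≡-Reasoning

  fixed-determined-by-half : ∀ a a′ → fixedByReflection (suc (p + p)) a ≡ true → fixedByReflection (suc (p + p)) a′ ≡ true →
    (∀ t → t < suc k′ → entry a (t + suc p) ≡ entry a′ (t + suc p)) → a ≡ a′
  fixed-determined-by-half a a′ fixed fixed′ agree = lk-ext a a′ λ x x<2k →
    let (t , t<k , to-half) = reaches-half x x<2k in begin
      lk a x                ≡⟨ sym (entry-below a x x<2k) ⟩
      entry a x             ≡⟨ to-half a fixed ⟩
      entry a (t + suc p)   ≡⟨ agree t t<k ⟩
      entry a′ (t + suc p)  ≡⟨ sym (to-half a′ fixed′) ⟩
      entry a′ x            ≡⟨ entry-below a′ x x<2k ⟩
      lk a′ x               ∎
    where open ≡-Reasoning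

  rotated-halfOf : ∀ a → fixedByReflection (suc (p + p)) a ≡ true → rotatedPalindrome (halfOf a) ≡ a
  rotated-halfOf a fixed = fixed-determined-by-half (rotatedPalindrome (halfOf a)) a (rotated-fixed (halfOf a)) fixed
    λ t t<k → trans (rotated-half (halfOf a) t t<k) (lk-build (λ t → entry a (t + suc p)) (suc k′) t t<k)

  ones-rotated : ∀ b → ones (rotatedPalindrome b) ≡ ones b + ones b
  ones-rotated b = trans (ones-rots (gap + suc k′) (palindrome b))
    (trans (ones-++ b (V.reverse b)) (cong (_+_ (ones b)) (ones-reverse b)))

  rotated-window⇒window : ∀ b {L} s → ZeroWindow (rotatedPalindrome b) L s → ZeroWindow (palindrome b) L (s + (gap + suc k′))
  rotated-window⇒window b s window j j<L =
    trans (cong (entry (palindrome b)) (+-swap-last s (gap + suc k′) j)) (trans (sym (rotated-entry b (s + j))) (window j j<L))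

  window⇒rotated-window : ∀ b {L} s → ZeroWindow (palindrome b) L s → ZeroWindow (rotatedPalindrome b) L (s + suc p)
  window⇒rotated-window b s window j j<L = begin
    entry (rotatedPalindrome b) (s + suc p + j)                  ≡⟨ rotated-entry b (s + suc p + j) ⟩
    entry (palindrome b) (s + suc p + j + (gap + suc k′))        ≡⟨ cong (entry (palindrome b))
                                                                     (linear {s + suc p + j + (gap + suc k′)} {s + j + (suc k′ + suc k′)} half
                                                                       (solve (atoms (s ∷ j ∷ p ∷ gap ∷ k′ ∷ [])))) ⟩
    entry (palindrome b) (s + j + (suc k′ + suc k′))             ≡⟨ entry-periodic (palindrome b) (s + j) ⟩
    entry (palindrome b) (s + j)                                 ≡⟨ window j j<L ⟩
    false                                                        ∎
    where open ≡-Reasoning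

ℤ-rearrange : ∀ X A B C → X + A ≡ B + C → + X ≡ + B ℤ.- + A ℤ.+ + C
ℤ-rearrange X A B C h = begin
    + X                        ≡⟨ add-sub (+ X) (+ A) ⟩
    (+ X ℤ.+ + A) ℤ.- + A      ≡⟨ cong (λ z → z ℤ.- + A) (trans (sym (ℤ.pos-+ X A)) (trans (cong +_ h) (ℤ.pos-+ B C))) ⟩
    (+ B ℤ.+ + C) ℤ.- + A      ≡⟨ swap-sub (+ B) (+ C) (+ A) ⟩
    + B ℤ.- + A ℤ.+ + C        ∎
  where
  open ≡-Reasoning
  add-sub : ∀ x a → x ≡ (x ℤ.+ a) ℤ.- a
  add-sub = ℤ-Solver.solve-∀
  swap-sub : ∀ b c a → (b ℤ.+ c) ℤ.- a ≡ b ℤ.- a ℤ.+ c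
  swap-sub = ℤ-Solver.solve-∀

ℤ-rearrange-twice : ∀ X Y B → X + Y + Y ≡ B → + X ≡ + B ℤ.- + 2 ℤ.* + Y
ℤ-rearrange-twice X Y B h =
  trans (ℤ-rearrange X (2 * Y) B 0 (trans (regroup X Y) (trans h (sym (+-identityʳ B)))))
    (trans (ℤ.+-identityʳ _) (cong (λ z → + B ℤ.- z) (ℤ.pos-* 2 Y)))
  where
  regroup : ∀ X Y → X + 2 * Y ≡ X + Y + Y
  regroup = solve-∀

-- Good fixed tuples.  With k = r + c, c ∈ {r, r + 1}, and q = 2p + 1 < 2k, the
-- rotated palindrome of b is good exactly when b has a one among its first r and
-- among its last r positions.
module GoodFixed (k′ r c p gap : ℕ) (split : r + c ≡ suc k′) (r≤c : r ≤ c) (c≤r+1 : c ≤ suc r)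
                 (half : p + gap ≡ k′) where
  open ReflectionFixed k′ p gap half
  open PalindromeWindows k′ r c split r≤c c≤r+1

  one-in-rotated : ∀ b → ones b ≢ 0 → ∃ λ i → entry (rotatedPalindrome b) i ≡ true
  one-in-rotated b ones≢0 = let (t , t<k , one) = ones≢0⇒one b ones≢0 in t + suc p , trans (rotated-half b t t<k) one

  -- For b with a one, the bad blocks of its rotated palindrome are its zero windows
  -- of length k - 1, which in turn are the vanishing end segments of b.
  has-bad-block : ∀ b → ones b ≢ 0 →
    hasBadBlock (rotatedPalindrome b) ≡ zeroOn (_<ᵇ r) b ∨ zeroOn (c ≤ᵇ_) b
  has-bad-block b ones≢0 with zeroOn (_<ᵇ r) b in zero-start | zeroOn (c ≤ᵇ_) b in zero-end
  ... | true | _ = let (i , one) = one-in-rotated b ones≢0 in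
    window⇒badBlock (rotatedPalindrome b) i k′ (suc k′ + c + suc p) one
      (window⇒rotated-window b (suc k′ + c) (zero-start⇒window b zero-start)) (≤-reflexive (badLength-double k′))
  ... | false | true = let (i , one) = one-in-rotated b ones≢0 in
    window⇒badBlock (rotatedPalindrome b) i k′ (c + suc p) one
      (window⇒rotated-window b c (zero-end⇒window b zero-end)) (≤-reflexive (badLength-double k′))
  ... | false | false with hasBadBlock (rotatedPalindrome b) in bad
  ...   | false = refl
  ...   | true with badBlock⇒window (rotatedPalindrome b) bad
  ...     | (s , window) with window⇒zero-start-or-end b (s + (gap + suc k′))
                               (rotated-window⇒window b s (subst (λ L → ZeroWindow (rotatedPalindrome b) L s) (badLength-double k′) window))
  ...       | inj₁ zs = ⊥-elim (true≢false (trans (sym zs) zero-start))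
  ...       | inj₂ ze = ⊥-elim (true≢false (trans (sym ze) zero-end))

  -- The rotated palindrome of b is good exactly when b has ones at both ends: without
  -- ones both are all zero, and otherwise has-bad-block applies.
  rotated-good : ∀ b → isGood (rotatedPalindrome b) ≡ onesAtBothEnds r c b
  rotated-good b with ones b ≟ 0
  ... | yes ones≡0 rewrite ones≡0⇒allZero (rotatedPalindrome b) (trans (ones-rotated b) (cong₂ _+_ ones≡0 ones≡0))
                         | zeroOn-intro (_<ᵇ r) b (λ t _ _ → ones≡0⇒no-one b ones≡0 t) = refl
  ... | no ones≢0 = begin
      not (allZero (rotatedPalindrome b) ∨ hasBadBlock (rotatedPalindrome b))
    ≡⟨ cong₂ (λ x y → not (x ∨ y)) (one⇒¬allZero (rotatedPalindrome b) (proj₁ one) (proj₂ one)) (has-bad-block b ones≢0) ⟩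
      not (zeroOn (_<ᵇ r) b ∨ zeroOn (c ≤ᵇ_) b)
    ≡⟨ deMorgan₂ (zeroOn (_<ᵇ r) b) (zeroOn (c ≤ᵇ_) b) ⟩
      onesAtBothEnds r c b ∎
    where
    open ≡-Reasoning
    one = one-in-rotated b ones≢0

  -- Counting good fixed tuples (with any condition h on the number of ones) reduces,
  -- along the bijection b ↦ rotated palindrome, to counting halves.
  count-good-fixed : ∀ (h : ℕ → Bool) →
    count (λ a → isGood a ∧ h (ones a) ∧ fixedByReflection (suc (p + p)) a) (allTuples (suc k′ + suc k′))
    ≡ count (λ b → onesAtBothEnds r c b ∧ h (ones b + ones b)) (allTuples (suc k′))
  count-good-fixed h = count-bijection _ _ rotatedPalindrome halfOf halfOf-rotated
    (λ a good → rotated-halfOf a (∧-conicalʳ (h (ones a)) _ (∧-conicalʳ (isGood a) _ good)))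
    on-rotated
    where
    on-rotated : ∀ b → isGood (rotatedPalindrome b) ∧ h (ones (rotatedPalindrome b)) ∧ fixedByReflection (suc (p + p)) (rotatedPalindrome b)
                       ≡ onesAtBothEnds r c b ∧ h (ones b + ones b)
    on-rotated b rewrite rotated-good b | ones-rotated b | rotated-fixed b = cong (_∧_ (onesAtBothEnds r c b)) (∧-identityʳ _)

  count-good-fixed-equation : ∀ (h : ℕ → Bool) →
    count (λ a → isGood a ∧ h (ones a) ∧ fixedByReflection (suc (p + p)) a) (allTuples (suc k′ + suc k′))
      + count (λ v → h (ones v + ones v)) (allTuples c) + count (λ v → h (ones v + ones v)) (allTuples c)
    ≡ count (λ v → h (ones v + ones v)) (allTuples (suc k′)) + count (λ v → h (ones v + ones v)) (allTuples (c ∸ r))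
  count-good-fixed-equation h =
    trans (cong (λ x → x + X c + X c) (count-good-fixed h)) (count-onesAtBothEnds r c split (λ o → h (o + o)))
    where
    X : ℕ → ℕ
    X f = count (λ v → h (ones v + ones v)) (allTuples f)

  fixG-equation : fixG (suc k′ + suc k′) (suc (p + p)) + 2 ^ c + 2 ^ c ≡ 2 ^ suc k′ + 2 ^ (c ∸ r)
  fixG-equation = begin
    fixG (suc k′ + suc k′) (suc (p + p)) + 2 ^ c + 2 ^ c
      ≡⟨ cong₂ (λ x y → x + y + y) (length-filter _ (allTuples (suc k′ + suc k′))) (sym (count-all c)) ⟩
    count (λ a → isGood a ∧ true ∧ fixedByReflection (suc (p + p)) a) (allTuples (suc k′ + suc k′)) + X c + X c
      ≡⟨ count-good-fixed-equation (λ _ → true) ⟩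
    X (suc k′) + X (c ∸ r)
      ≡⟨ cong₂ _+_ (count-all (suc k′)) (count-all (c ∸ r)) ⟩
    2 ^ suc k′ + 2 ^ (c ∸ r) ∎
    where
    open ≡-Reasoning
    X : ℕ → ℕ
    X f = count (λ (v : Vec Bool f) → true) (allTuples f)

  fixGm-equation : ∀ m → fixGm m (suc k′ + suc k′) (suc (p + p)) + binomHalf c m + binomHalf c m
                         ≡ binomHalf (suc k′) m + binomHalf (c ∸ r) m
  fixGm-equation m = begin
    fixGm m (suc k′ + suc k′) (suc (p + p)) + binomHalf c m + binomHalf c m
      ≡⟨ cong₂ (λ x y → x + y + y) (length-filter _ (allTuples (suc k′ + suc k′))) (sym (count-double-ones c m)) ⟩
    count (λ a → isGood a ∧ (ones a ≡ᵇ m) ∧ fixedByReflection (suc (p + p)) a) (allTuples (suc k′ + suc k′)) + X c + X c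
      ≡⟨ count-good-fixed-equation (_≡ᵇ m) ⟩
    X (suc k′) + X (c ∸ r)
      ≡⟨ cong₂ _+_ (count-double-ones (suc k′) m) (count-double-ones (c ∸ r) m) ⟩
    binomHalf (suc k′) m + binomHalf (c ∸ r) m ∎
    where
    open ≡-Reasoning
    X : ℕ → ℕ
    X f = count (λ (v : Vec Bool f) → ones v + ones v ≡ᵇ m) (allTuples f)

  part-i : ∀ a → (suc k′ + suc k′ + a) / 4 ≡ suc c →
    + fixG (suc k′ + suc k′) (suc (p + p))
      ≡ + (2 ^ ((suc k′ + suc k′) / 2)) ℤ.- + (2 ^ ((suc k′ + suc k′ + a) / 4)) ℤ.+ + (2 ^ (c ∸ r))
  part-i a [n+a]/4≡c+1 =
    trans (ℤ-rearrange (fixG (suc k′ + suc k′) (suc (p + p))) (2 ^ suc c) (2 ^ suc k′) (2 ^ (c ∸ r))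
            (trans (+-double _ (2 ^ c)) fixG-equation))
      (cong₂ (λ x y → + (2 ^ x) ℤ.- + (2 ^ y) ℤ.+ + (2 ^ (c ∸ r))) (sym (double-half (suc k′))) (sym [n+a]/4≡c+1))

  -- Part (ii): fix_m = binomHalf k m - 2 binomHalf c m, as binomHalf (c - r) m = 0 for m ≥ 3.
  part-ii : (suc k′ + suc k′ + 2) / 4 ≡ c → ∀ m → 3 ≤ m → m ≤ suc k′ + suc k′ →
    + fixGm m (suc k′ + suc k′) (suc (p + p))
      ≡ + binomHalf ((suc k′ + suc k′) / 2) m ℤ.- + 2 ℤ.* + binomHalf ((suc k′ + suc k′ + 2) / 4) m
  part-ii [n+2]/4≡c m 3≤m _ =
    trans (ℤ-rearrange-twice (fixGm m (suc k′ + suc k′) (suc (p + p))) (binomHalf c m) (binomHalf (suc k′) m)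
            (trans (fixGm-equation m) (trans (cong (_+_ (binomHalf (suc k′) m)) (binomHalf-small (c ∸ r) m c-r≤1 3≤m))
              (+-identityʳ _))))
      (cong₂ (λ a c → + binomHalf a m ℤ.- + 2 ℤ.* + binomHalf c m) (sym (double-half (suc k′))) (sym [n+2]/4≡c))
    where
    c-r≤1 : c ∸ r ≤ 1
    c-r≤1 = subst (c ∸ r ≤_) (trans (cong (_∸ r) (+-comm 1 r)) (m+n∸m≡n r 1)) (∸-monoˡ-≤ r c≤r+1)


Conclusion : ℕ → ℕ → Set
Conclusion n q =
  ((n % 4 ≡ 0 → + fixG n q ≡ + (2 ^ (n / 2)) ℤ.- + (2 ^ ((n + 4) / 4)) ℤ.+ + 1)
    × (n % 4 ≡ 2 → + fixG n q ≡ + (2 ^ (n / 2)) ℤ.- + (2 ^ ((n + 6) / 4)) ℤ.+ + 2))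
  × (∀ m → 3 ≤ m → m ≤ n → + fixGm m n q ≡ + binomHalf (n / 2) m ℤ.- + 2 ℤ.* + binomHalf ((n + 2) / 4) m)

conclusion-for : ∀ k′ r e p gap → r + (r + e) ≡ suc k′ → e ≤ 1 → p + gap ≡ k′ →
  Conclusion (suc k′ + suc k′) (suc (p + p))
conclusion-for k′ r zero p gap split _ half =
  ((λ _ → trans (part-i 4 [n+4]/4≡c+1)
     (cong (λ x → + (2 ^ ((suc k′ + suc k′) / 2)) ℤ.- + (2 ^ ((suc k′ + suc k′ + 4) / 4)) ℤ.+ + (2 ^ x)) (m+n∸m≡n r 0))) ,
   (λ n%4≡2 → ⊥-elim (0≢1+n (trans (sym n%4≡0) n%4≡2)))) ,
  part-ii [n+2]/4≡c
  where
  open GoodFixed k′ r (r + 0) p gap split (m≤m+n r 0) (subst (r + 0 ≤_) (+-comm r 1) (+-monoʳ-≤ r z≤n)) half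
  n%4≡0 : (suc k′ + suc k′) % 4 ≡ 0
  n%4≡0 = trans (cong (_% 4) (linear {suc k′ + suc k′} {0 + r * 4} (cong₂ _+_ (sym split) (sym split))
            (solve (atoms (r ∷ k′ ∷ []))))) ([m+kn]%n≡m%n 0 r 4)
  [n+2]/4≡c : (suc k′ + suc k′ + 2) / 4 ≡ r + 0
  [n+2]/4≡c = trans (cong (_/ 4) (linear {suc k′ + suc k′ + 2} {2 + (r + 0) * 4} (cong₂ _+_ (sym split) (sym split))
                (solve (atoms (r ∷ k′ ∷ []))))) (quotient-by-4 2 (r + 0) (s≤s (s≤s (s≤s z≤n))))
  [n+4]/4≡c+1 : (suc k′ + suc k′ + 4) / 4 ≡ suc (r + 0)
  [n+4]/4≡c+1 = trans (cong (_/ 4) (linear {suc k′ + suc k′ + 4} {0 + suc (r + 0) * 4} (cong₂ _+_ (sym split) (sym split))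
                  (solve (atoms (r ∷ k′ ∷ []))))) (quotient-by-4 0 (suc (r + 0)) (s≤s z≤n))
conclusion-for k′ r (suc zero) p gap split _ half =
  ((λ n%4≡0 → ⊥-elim (0≢1+n (trans (sym n%4≡0) n%4≡2))) ,
   (λ _ → trans (part-i 6 [n+6]/4≡c+1)
     (cong (λ x → + (2 ^ ((suc k′ + suc k′) / 2)) ℤ.- + (2 ^ ((suc k′ + suc k′ + 6) / 4)) ℤ.+ + (2 ^ x)) (m+n∸m≡n r 1)))) ,
  part-ii [n+2]/4≡c
  where
  open GoodFixed k′ r (r + 1) p gap split (m≤m+n r 1) (subst (r + 1 ≤_) (+-comm r 1) ≤-refl) half
  n%4≡2 : (suc k′ + suc k′) % 4 ≡ 2
  n%4≡2 = trans (cong (_% 4) (linear {suc k′ + suc k′} {2 + r * 4} (cong₂ _+_ (sym split) (sym split))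
            (solve (atoms (r ∷ k′ ∷ []))))) ([m+kn]%n≡m%n 2 r 4)
  [n+2]/4≡c : (suc k′ + suc k′ + 2) / 4 ≡ r + 1
  [n+2]/4≡c = trans (cong (_/ 4) (linear {suc k′ + suc k′ + 2} {0 + (r + 1) * 4} (cong₂ _+_ (sym split) (sym split))
                (solve (atoms (r ∷ k′ ∷ []))))) (quotient-by-4 0 (r + 1) (s≤s z≤n))
  [n+6]/4≡c+1 : (suc k′ + suc k′ + 6) / 4 ≡ suc (r + 1)
  [n+6]/4≡c+1 = trans (cong (_/ 4) (linear {suc k′ + suc k′ + 6} {0 + suc (r + 1) * 4} (cong₂ _+_ (sym split) (sym split))
                  (solve (atoms (r ∷ k′ ∷ []))))) (quotient-by-4 0 (suc (r + 1)) (s≤s z≤n))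
conclusion-for k′ r (suc (suc e)) p gap split (s≤s ()) half

-- A fixed-point-free reflection x ↦ q - x has odd q: for q = 2i, the point i is fixed.
fixed-point-free⇒odd : ∀ n′ q → q < suc n′ → (∀ x → x < suc n′ → reflect (suc n′) q x ≢ x) → ∃ λ p → q ≡ suc (p + p)
fixed-point-free⇒odd n′ q q<n fixed-point-free with parity q
... | inj₂ odd = odd
... | inj₁ (i , refl) = ⊥-elim (fixed-point-free i i<n i-fixed)
  where
  i<n : i < suc n′
  i<n = ≤-<-trans (m≤m+n i i) q<n
  i-fixed : reflect (suc n′) (i + i) i ≡ i
  i-fixed = trans (cong (_% suc n′) (trans (cong (_∸ i) (+-assoc i i (suc n′))) (m+n∸m≡n i (i + suc n′))))
    (trans ([m+n]%n≡m%n i (suc n′)) (m<n⇒m%n≡m i<n))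

record Shape (n q : ℕ) : Set where
  field
    k′ r e p gap : ℕ
    n≡2k : n ≡ suc k′ + suc k′
    q≡2p+1 : q ≡ suc (p + p)
    k≡2r+e : r + (r + e) ≡ suc k′
    e≤1 : e ≤ 1
    p+gap≡k′ : p + gap ≡ k′

shape : ∀ n′ → suc n′ % 2 ≡ 0 → ∀ q → q < suc n′ → (∀ x → x < suc n′ → reflect (suc n′) q x ≢ x) → Shape (suc n′) q
shape n′ even q q<n fixed-point-free = record
  { k′ = k′ ; r = K / 2 ; e = K % 2 ; p = p ; gap = gap
  ; n≡2k = trans n≡K+K (cong₂ _+_ K≡k K≡k)
  ; q≡2p+1 = q≡2p+1
  ; k≡2r+e = trans (sym (halves (K % 2) (K / 2))) (trans (sym (m≡m%n+[m/n]*n K 2)) K≡k)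
  ; e≤1 = s≤s⁻¹ (m%n<n K 2)
  ; p+gap≡k′ = p+gap≡k′
  }
  where
  halves : ∀ e r → e + r * 2 ≡ r + (r + e)
  halves = solve-∀
  K = suc n′ / 2
  n≡K+K : suc n′ ≡ K + K
  n≡K+K = trans (m≡m%n+[m/n]*n (suc n′) 2) (trans (cong (_+ K * 2) even) (sym (double≡*2 K)))
  0<K : 0 < K
  0<K = n≢0⇒n>0 λ K≡0 → 0≢1+n (sym (trans n≡K+K (cong₂ _+_ K≡0 K≡0)))
  k′ = proj₁ (difference 0<K)
  K≡k : K ≡ suc k′
  K≡k = sym (proj₂ (difference 0<K))
  p = proj₁ (fixed-point-free⇒odd n′ q q<n fixed-point-free)
  q≡2p+1 = proj₂ (fixed-point-free⇒odd n′ q q<n fixed-point-free)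
  p<k : p < suc k′
  p<k = ≰⇒> λ k≤p → <-irrefl refl (<-≤-trans (subst (_< suc n′) q≡2p+1 q<n)
          (subst (_≤ suc (p + p)) (sym (trans n≡K+K (cong₂ _+_ K≡k K≡k))) (≤-trans (+-mono-≤ k≤p k≤p) (n≤1+n (p + p)))))
  gap = proj₁ (difference (s≤s⁻¹ p<k))
  p+gap≡k′ = proj₂ (difference (s≤s⁻¹ p<k))

lemma3p5 : (n : ℕ) → 4 ≤ n → n % 2 ≡ 0 →
    (q : ℕ) → q < n → (∀ x → x < n → reflect n q x ≢ x) →
    ((n % 4 ≡ 0 → + fixG n q ≡ + (2 ^ (n / 2)) ℤ.- + (2 ^ ((n + 4) / 4)) ℤ.+ + 1)
      × (n % 4 ≡ 2 → + fixG n q ≡ + (2 ^ (n / 2)) ℤ.- + (2 ^ ((n + 6) / 4)) ℤ.+ + 2))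
    × (∀ m → 3 ≤ m → m ≤ n →
        + fixGm m n q ≡ + binomHalf (n / 2) m ℤ.- + 2 ℤ.* + binomHalf ((n + 2) / 4) m)
lemma3p5 (suc n′) _ even q q<n fixed-point-free =
  subst₂ Conclusion (sym n≡2k) (sym q≡2p+1) (conclusion-for k′ r e p gap k≡2r+e e≤1 p+gap≡k′)
  where open Shape (shape n′ even q q<n fixed-point-free)
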